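{- Let $m\ge1$ and let $k_1,\ldots,k_m$, $n_1,\ldots,n_m$ be integers with $n_i \geq k_i > 0$ for all $i \in [m]$, and let $M$ be a $(k_1, \ldots, k_m; n_1, \ldots, n_m)$ circulant block diagonal matrix. If $M$ is not an all-one matrix, then \[\mathrm{rank}_{\mathbb{R}}(M) = \mathrm{rank}_{\mathbb{R}}(\overline{M}) = \sum_{i=1}^{m}{(n_i-\gcd(n_i,k_i)+1)}.\]
   Context: For integers $n \ge k \ge 0$, $D_{n,k}$ denotes the $n\times n$ circulant $0,1$ matrix whose first row consists of $n-k$ ones followed by $k$ zeros, each subsequent row being the cyclic shift of the previous row by one position to the right. For integers $n_i \ge k_i \ge 0$ ($i\in[m]$), a matrix is called $(k_1,\ldots,k_m;n_1,\ldots,n_m)$ circulant block diagonal if it is a block matrix with $m$ diagonal blocks whose $i$th diagonal block is $D_{n_i,n_i-k_i}$ and all of whose other entries are zero. $\overline{M}$ is the complement of $M$ (zeros and ones swapped). $\mathrm{rank}_{\mathbb{R}}$ is the rank over the reals.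
   Formalization: The rank of $M$ and of $\overline{M}$ is taken over ℚ rather than over the reals. -}

module Defs where

open import Data.Nat using (ℕ; zero; suc; _+_; _∸_; _≤ᵇ_; _<ᵇ_)
open import Data.Nat.GCD using (gcd)
open import Data.Fin using (Fin; zero; suc; toℕ)
open import Data.Bool using (Bool; true; false; if_then_else_; not)
open import Data.Product using (Σ; _×_; _,_; ∃)
open import Data.Rational using (ℚ; 0ℚ; 1ℚ) renaming (_+_ to _+ℚ_; _*_ to _*ℚ_)
open import Function.Definitions using (Injective)
open import Relation.Binary.PropositionalEquality using (_≡_)
open import Relation.Nullary using (¬_)

sumℕ : (r : ℕ) → (Fin r → ℕ) → ℕ
sumℕ zero    f = 0
sumℕ (suc r) f = f zero + sumℕ r (λ j → f (suc j))

sumℚ : (r : ℕ) → (Fin r → ℚ) → ℚ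
sumℚ zero    f = 0ℚ
sumℚ (suc r) f = f zero +ℚ sumℚ r (λ j → f (suc j))

-- Row/column index set of a block diagonal matrix with blocks of sizes n i:
-- a pair (block i, position a within block i).
Idx : (m : ℕ) → (Fin m → ℕ) → Set
Idx m n = Σ (Fin m) (λ i → Fin (n i))

BMat : Set → Set
BMat I = I → I → Bool

complement : {I : Set} → BMat I → BMat I
complement M x y = not (M x y)

allOne : {I : Set} → BMat I → Set
allOne M = ∀ x y → M x y ≡ true

toℚ : Bool → ℚ
toℚ true  = 1ℚ
toℚ false = 0ℚ

-- Entry (a, b) (0-indexed) of D_{n, n-k}: the first row is k ones followed by
-- n-k zeros, row a is the first row cyclically shifted right by a, so the
-- entry is 1 iff (b - a) mod n < k.
circEntry : (n k : ℕ) → Fin n → Fin n → Bool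
circEntry n k a b =
  if toℕ a ≤ᵇ toℕ b
  then toℕ b ∸ toℕ a <ᵇ k
  else (toℕ b + n) ∸ toℕ a <ᵇ k

circBlockDiag : (m : ℕ) (n k : Fin m → ℕ) → BMat (Idx m n)
circBlockDiag m n k (i , a) (j , b) with i Data.Fin.≟ j
... | Relation.Nullary.yes Relation.Binary.PropositionalEquality.refl = circEntry (n i) k' a b
  where k' = k i
... | Relation.Nullary.no _ = false

RowsIndependent : {I : Set} → BMat I → (r : ℕ) → (Fin r → I) → Set
RowsIndependent {I} M r ρ =
  (c : Fin r → ℚ) →
  (∀ y → sumℚ r (λ j → c j *ℚ toℚ (M (ρ j) y)) ≡ 0ℚ) →
  ∀ j → c j ≡ 0ℚ

HasIndependentRows : {I : Set} → BMat I → ℕ → Set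
HasIndependentRows {I} M r =
  Σ (Fin r → I) (λ ρ → Injective _≡_ _≡_ ρ × RowsIndependent M r ρ)

IsRank : {I : Set} → BMat I → ℕ → Set
IsRank M r = HasIndependentRows M r × ¬ HasIndependentRows M (suc r)

{-# OPTIONS --safe #-}

-- Write D for one block D_{n,n−k} and g = gcd n k. Moving to the next row of D trades the unit vector
-- e_a for e_{a+k}, and moving to the next column trades e_b for e_{b−k} (indices mod n).
--
-- Upper bound: since a + k ≡ a (mod g), every row of D is row 0 plus a combination of the n − g
-- vectors e_x − e_{x+g}; the same holds for the complement with 1 − row 0 in place of row 0. So all rows
-- lie in the span of Σ (n_i − g_i + 1) vectors, and Steinitz exchange bounds the number of independent rows.
--
-- Lower bound: take the first n_i − g_i + 1 rows of each block. If a combination c of them has every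
-- column sum equal to C, then inside a block c (padded with zeros) is invariant under a ↦ a + k mod n,
-- hence g-periodic; as it vanishes on the last g − 1 positions, it is c₀ on multiples of g and 0 elsewhere.
-- Column k − 1 then gives C = (k/g) c₀, and the total is Σ c = (n/g) c₀. For M, C = 0 forces c = 0. For the
-- complement, all column sums of the rows of M equal Σ c, so (k_i/g_i) c₀ᵢ = Σ_i (n_i/g_i) c₀ᵢ = C for
-- every block, and a sign argument gives C = 0 unless M is a single block with k = n, i.e. all ones.

module Submission where

open import Defs
open import Data.Nat using (ℕ; zero; suc; z≤n; s≤s; _+_; _∸_; _*_; _≤_; _<_; _≡ᵇ_; _<ᵇ_; _≤ᵇ_; _%_; _/_; NonZero; >-nonZero)
import Data.Nat.Properties as ℕₚ
open import Data.Nat.DivMod using (m<n⇒m%n≡m; [m+n]%n≡m%n; m%n<n; m%n%n≡m%n; %-distribˡ-+; %-remove-+ʳ; m≡m%n+[m/n]*n; %-congˡ)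
open import Data.Nat.Divisibility using (_∣_; ∣⇒≤)
open import Data.Nat.GCD using (gcd; gcd-GCD; module Bézout; gcd[m,n]∣m; gcd[m,n]∣n; gcd[m,n]≢0)
open import Data.Fin using (Fin; zero; suc; toℕ; fromℕ<; _↑ˡ_; _↑ʳ_; splitAt; punchIn; _≟_)
import Data.Fin.Properties as Finₚ
open import Data.Fin.Properties using (any?)
open import Data.Bool using (true; false; T; not; if_then_else_)
open import Data.Bool.Properties using (T-≡)
open import Data.Empty using (⊥-elim)
open import Data.Sum using (_⊎_; inj₁; inj₂)
import Data.Sum as Sum
open import Data.Product using (Σ; ∃; _×_; _,_; proj₁; proj₂)
open import Data.Vec.Functional using (insertAt)
open import Data.Vec.Functional.Properties using (insertAt-lookup; insertAt-punchIn)
open import Data.Rational using (ℚ; 0ℚ; 1ℚ; 1/_)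
  renaming (_+_ to _+ℚ_; _*_ to _*ℚ_; -_ to -ℚ_; _≤_ to _≤ℚ_; _<_ to _<ℚ_)
open import Data.Rational.Base using (≢-nonZero)
import Data.Rational.Properties as ℚₚ
open import Data.Rational.Solver using (module +-*-Solver)
open import Algebra.Properties.Group ℚₚ.+-0-group using (∙-cancelˡ; x∙y⁻¹≈ε⇒x≈y)
open import Algebra.Properties.Monoid.Mult ℚₚ.+-0-monoid using (×-homo-+) renaming (_×_ to _·_)
open import Function using (_∘_; Equivalence)
open import Relation.Binary.Definitions using (tri<; tri≈; tri>)
open import Relation.Binary.PropositionalEquality
open import Relation.Nullary using (¬_; yes; no; ¬?)
open import Relation.Nullary.Decidable using (decidable-stable)
open import Relation.Nullary.Negation using (¬∃⟶∀¬)

open +-*-Solver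

open import Defs

-- Finite sums over ℚ

∑ : ℕ → (ℕ → ℚ) → ℚ
∑ zero    f = 0ℚ
∑ (suc N) f = f 0 +ℚ ∑ N (f ∘ suc)

syntax ∑ N (λ a → e) = ∑[ a < N ] e

∑-cong : ∀ N {f g : ℕ → ℚ} → (∀ a → a < N → f a ≡ g a) → ∑ N f ≡ ∑ N g
∑-cong zero    eq = refl
∑-cong (suc N) eq = cong₂ _+ℚ_ (eq 0 (s≤s z≤n)) (∑-cong N (λ a a<N → eq (suc a) (s≤s a<N)))

∑-zero : ∀ N {f : ℕ → ℚ} → (∀ a → a < N → f a ≡ 0ℚ) → ∑ N f ≡ 0ℚ
∑-zero zero    eq = refl
∑-zero (suc N) eq = cong₂ _+ℚ_ (eq 0 (s≤s z≤n)) (∑-zero N (λ a a<N → eq (suc a) (s≤s a<N)))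

∑-distrib-+ : ∀ N (f g : ℕ → ℚ) → ∑[ a < N ] (f a +ℚ g a) ≡ ∑ N f +ℚ ∑ N g
∑-distrib-+ zero    f g = refl
∑-distrib-+ (suc N) f g = trans (cong (f 0 +ℚ g 0 +ℚ_) (∑-distrib-+ N (f ∘ suc) (g ∘ suc)))
  (solve 4 (λ a b c d → (a :+ b) :+ (c :+ d) := (a :+ c) :+ (b :+ d)) refl (f 0) (g 0) (∑ N (f ∘ suc)) (∑ N (g ∘ suc)))

∑-neg : ∀ N (f : ℕ → ℚ) → ∑[ a < N ] (-ℚ f a) ≡ -ℚ ∑ N f
∑-neg zero    f = refl
∑-neg (suc N) f = trans (cong (-ℚ f 0 +ℚ_) (∑-neg N (f ∘ suc))) (sym (ℚₚ.neg-distrib-+ (f 0) _))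

∑-split : ∀ N M (f : ℕ → ℚ) → ∑ (N + M) f ≡ ∑ N f +ℚ ∑[ a < M ] f (N + a)
∑-split zero    M f = sym (ℚₚ.+-identityˡ _)
∑-split (suc N) M f = trans (cong (f 0 +ℚ_) (∑-split N M (f ∘ suc))) (sym (ℚₚ.+-assoc (f 0) _ _))

∑-truncate : ∀ {N M} (f : ℕ → ℚ) → N ≤ M → (∀ a → N ≤ a → a < M → f a ≡ 0ℚ) → ∑ M f ≡ ∑ N f
∑-truncate {N} {M} f N≤M vanish = begin
  ∑ M f                                ≡⟨ cong (λ L → ∑ L f) (sym (ℕₚ.m+[n∸m]≡n N≤M)) ⟩
  ∑ (N + (M ∸ N)) f                    ≡⟨ ∑-split N (M ∸ N) f ⟩
  ∑ N f +ℚ ∑[ a < M ∸ N ] f (N + a)    ≡⟨ cong (∑ N f +ℚ_) (∑-zero (M ∸ N) tail-vanishes) ⟩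
  ∑ N f +ℚ 0ℚ                          ≡⟨ ℚₚ.+-identityʳ _ ⟩
  ∑ N f                                ∎
  where
  open ≡-Reasoning
  tail-vanishes : ∀ a → a < M ∸ N → f (N + a) ≡ 0ℚ
  tail-vanishes a a<M∸N = vanish (N + a) (ℕₚ.m≤m+n N a)
    (subst (N + a <_) (ℕₚ.m+[n∸m]≡n N≤M) (ℕₚ.+-monoʳ-< N a<M∸N))

δ : ℕ → ℕ → ℚ
δ a p = toℚ (a ≡ᵇ p)

δ-refl : ∀ a → δ a a ≡ 1ℚ
δ-refl zero    = refl
δ-refl (suc a) = δ-refl a

δ-≢ : ∀ {a p} → a ≢ p → δ a p ≡ 0ℚ
δ-≢ {a} {p} a≢p with a ≡ᵇ p in eq
... | false = refl
... | true  = ⊥-elim (a≢p (ℕₚ.≡ᵇ⇒≡ a p (subst T (sym eq) _)))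

δ-cong-⇔ : ∀ {a p u v} → (a ≡ p → u ≡ v) → (u ≡ v → a ≡ p) → δ a p ≡ δ u v
δ-cong-⇔ {a} {p} {u} {v} to from with a ≡ᵇ p in eq
... | true  = sym (trans (cong (λ x → δ x v) (to (ℕₚ.≡ᵇ⇒≡ a p (subst T (sym eq) _)))) (δ-refl v))
... | false = sym (δ-≢ (λ u≡v → subst T eq (ℕₚ.≡⇒≡ᵇ a p (from u≡v))))

∑-δ : ∀ N (f : ℕ → ℚ) p → p < N → ∑[ a < N ] (f a *ℚ δ a p) ≡ f p
∑-δ (suc N) f zero    _ = trans (cong₂ _+ℚ_ (ℚₚ.*-identityʳ (f 0)) (∑-zero N (λ a _ → ℚₚ.*-zeroʳ (f (suc a)))))
                                 (ℚₚ.+-identityʳ (f 0))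
∑-δ (suc N) f (suc p) (s≤s p<N) = trans (cong₂ _+ℚ_ (ℚₚ.*-zeroʳ (f 0)) (∑-δ N (f ∘ suc) p p<N))
                                         (ℚₚ.+-identityˡ (f (suc p)))

sumℚ-cong : ∀ N {f g : Fin N → ℚ} → (∀ j → f j ≡ g j) → sumℚ N f ≡ sumℚ N g
sumℚ-cong zero    eq = refl
sumℚ-cong (suc N) eq = cong₂ _+ℚ_ (eq zero) (sumℚ-cong N (eq ∘ suc))

sumℚ-zero : ∀ N {f : Fin N → ℚ} → (∀ j → f j ≡ 0ℚ) → sumℚ N f ≡ 0ℚ
sumℚ-zero zero    eq = refl
sumℚ-zero (suc N) eq = cong₂ _+ℚ_ (eq zero) (sumℚ-zero N (eq ∘ suc))

sumℚ-distrib-+ : ∀ N (f g : Fin N → ℚ) → sumℚ N (λ j → f j +ℚ g j) ≡ sumℚ N f +ℚ sumℚ N g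
sumℚ-distrib-+ zero    f g = refl
sumℚ-distrib-+ (suc N) f g = trans (cong (f zero +ℚ g zero +ℚ_) (sumℚ-distrib-+ N (f ∘ suc) (g ∘ suc)))
  (solve 4 (λ a b c d → (a :+ b) :+ (c :+ d) := (a :+ c) :+ (b :+ d)) refl
    (f zero) (g zero) (sumℚ N (f ∘ suc)) (sumℚ N (g ∘ suc)))

sumℚ-*ˡ : ∀ N x (f : Fin N → ℚ) → sumℚ N (λ j → x *ℚ f j) ≡ x *ℚ sumℚ N f
sumℚ-*ˡ zero    x f = sym (ℚₚ.*-zeroʳ x)
sumℚ-*ˡ (suc N) x f = trans (cong (x *ℚ f zero +ℚ_) (sumℚ-*ˡ N x (f ∘ suc)))
                            (sym (ℚₚ.*-distribˡ-+ x (f zero) _))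

sumℚ-neg : ∀ N (f : Fin N → ℚ) → sumℚ N (λ j → -ℚ f j) ≡ -ℚ sumℚ N f
sumℚ-neg zero    f = refl
sumℚ-neg (suc N) f = trans (cong (-ℚ f zero +ℚ_) (sumℚ-neg N (f ∘ suc))) (sym (ℚₚ.neg-distrib-+ (f zero) _))

sumℚ-++ : ∀ N M (f : Fin (N + M) → ℚ) →
          sumℚ (N + M) f ≡ sumℚ N (λ j → f (j ↑ˡ M)) +ℚ sumℚ M (λ j → f (N ↑ʳ j))
sumℚ-++ zero    M f = sym (ℚₚ.+-identityˡ _)
sumℚ-++ (suc N) M f = trans (cong (f zero +ℚ_) (sumℚ-++ N M (f ∘ suc))) (sym (ℚₚ.+-assoc (f zero) _ _))

sumℚ-single : ∀ N (f : Fin N → ℚ) i → (∀ j → j ≢ i → f j ≡ 0ℚ) → sumℚ N f ≡ f i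
sumℚ-single (suc N) f zero    off = trans (cong (f zero +ℚ_) (sumℚ-zero N (λ j → off (suc j) λ ())))
                                          (ℚₚ.+-identityʳ _)
sumℚ-single (suc N) f (suc i) off = trans
  (cong₂ _+ℚ_ (off zero λ ()) (sumℚ-single N (f ∘ suc) i (λ j j≢i → off (suc j) (j≢i ∘ Finₚ.suc-injective))))
  (ℚₚ.+-identityˡ _)

sumℚ-punchIn : ∀ N (f : Fin (suc N) → ℚ) p → sumℚ (suc N) f ≡ f p +ℚ sumℚ N (f ∘ punchIn p)
sumℚ-punchIn N       f zero    = refl
sumℚ-punchIn (suc N) f (suc p) = trans (cong (f zero +ℚ_) (sumℚ-punchIn N (f ∘ suc) p))
  (solve 3 (λ a b c → a :+ (b :+ c) := b :+ (a :+ c)) refl (f zero) (f (suc p)) _)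

sumℚ-toℕ : ∀ N (f : ℕ → ℚ) → sumℚ N (f ∘ toℕ) ≡ ∑ N f
sumℚ-toℕ zero    f = refl
sumℚ-toℕ (suc N) f = cong (f 0 +ℚ_) (sumℚ-toℕ N (f ∘ suc))

*-≢0 : ∀ {x y} → x ≢ 0ℚ → y ≢ 0ℚ → x *ℚ y ≢ 0ℚ
*-≢0 {x} {y} x≢0 y≢0 xy≡0 = y≢0 (begin
  y                     ≡⟨ sym (ℚₚ.*-identityˡ y) ⟩
  1ℚ *ℚ y               ≡⟨ cong (_*ℚ y) (sym (ℚₚ.*-inverseˡ x {{nonZero}})) ⟩
  x⁻¹ *ℚ x *ℚ y         ≡⟨ ℚₚ.*-assoc x⁻¹ x y ⟩
  x⁻¹ *ℚ (x *ℚ y)       ≡⟨ cong (x⁻¹ *ℚ_) xy≡0 ⟩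
  x⁻¹ *ℚ 0ℚ             ≡⟨ ℚₚ.*-zeroʳ x⁻¹ ⟩
  0ℚ                    ∎)
  where
  open ≡-Reasoning
  nonZero = ≢-nonZero x≢0
  x⁻¹ = (1/ x) {{nonZero}}

*-zeroˡ-+ : ∀ x s → 0ℚ *ℚ x +ℚ s ≡ s
*-zeroˡ-+ x s = trans (cong (_+ℚ s) (ℚₚ.*-zeroˡ x)) (ℚₚ.+-identityˡ s)

-- Linear dependence

module _ {I : Set} where

  lincomb : ∀ {s} → (Fin s → ℚ) → (Fin s → I → ℚ) → I → ℚ
  lincomb {s} c v y = sumℚ s (λ j → c j *ℚ v j y)

  Dependent : (s : ℕ) → (Fin s → I → ℚ) → Set
  Dependent s v = Σ (Fin s → ℚ) λ c → (∀ y → lincomb c v y ≡ 0ℚ) × ∃ λ j → c j ≢ 0ℚ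

  lincomb-linear : ∀ {r} (w : Fin r → I → ℚ) α β X Z y →
    α *ℚ lincomb X w y +ℚ β *ℚ lincomb Z w y ≡ lincomb (λ l → α *ℚ X l +ℚ β *ℚ Z l) w y
  lincomb-linear {r} w α β X Z y = begin
    α *ℚ sumℚ r (λ l → X l *ℚ w l y) +ℚ β *ℚ sumℚ r (λ l → Z l *ℚ w l y)
      ≡⟨ sym (cong₂ _+ℚ_ (sumℚ-*ˡ r α _) (sumℚ-*ˡ r β _)) ⟩
    sumℚ r (λ l → α *ℚ (X l *ℚ w l y)) +ℚ sumℚ r (λ l → β *ℚ (Z l *ℚ w l y))
      ≡⟨ sym (sumℚ-distrib-+ r _ _) ⟩
    sumℚ r (λ l → α *ℚ (X l *ℚ w l y) +ℚ β *ℚ (Z l *ℚ w l y))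
      ≡⟨ sumℚ-cong r (λ l → solve 5 (λ α β x z w → α :* (x :* w) :+ β :* (z :* w) := (α :* x :+ β :* z) :* w)
                                      refl α β (X l) (Z l) (w l y)) ⟩
    sumℚ r (λ l → (α *ℚ X l +ℚ β *ℚ Z l) *ℚ w l y) ∎
    where open ≡-Reasoning

  dependent-tail : ∀ {s} (v : Fin (suc s) → I → ℚ) → Dependent s (v ∘ suc) → Dependent (suc s) v
  dependent-tail v (c , vanish , j , cⱼ≢0) =
    insertAt c zero 0ℚ , (λ y → trans (*-zeroˡ-+ (v zero y) _) (vanish y)) , suc j , cⱼ≢0

  module _ {s} (v : Fin (suc s) → I → ℚ) (p : Fin (suc s)) (a : ℚ) (b : Fin s → ℚ) where

    eliminated : Fin s → I → ℚ
    eliminated j y = a *ℚ v (punchIn p j) y +ℚ (-ℚ b j) *ℚ v p y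

    dependent-unEliminate : a ≢ 0ℚ → Dependent s eliminated → Dependent (suc s) v
    dependent-unEliminate a≢0 (c , vanish , j , cⱼ≢0) = c̃ , vanish′ , punchIn p j , c̃ⱼ≢0
      where
      σ = punchIn p
      B = sumℚ s (λ j → c j *ℚ b j)
      c̃ = insertAt (λ j → a *ℚ c j) p (-ℚ B)
      c̃ⱼ≢0 : c̃ (σ j) ≢ 0ℚ
      c̃ⱼ≢0 eq = *-≢0 a≢0 cⱼ≢0 (trans (sym (insertAt-punchIn _ p _ j)) eq)
      vanish′ : ∀ y → lincomb c̃ v y ≡ 0ℚ
      vanish′ y = begin
        lincomb c̃ v y
          ≡⟨ sumℚ-punchIn s (λ x → c̃ x *ℚ v x y) p ⟩
        c̃ p *ℚ v p y +ℚ sumℚ s (λ j → c̃ (σ j) *ℚ v (σ j) y)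
          ≡⟨ cong₂ _+ℚ_ (cong (_*ℚ v p y) (insertAt-lookup _ p _))
                        (sumℚ-cong s (λ j → cong (_*ℚ v (σ j) y) (insertAt-punchIn _ p _ j))) ⟩
        (-ℚ B) *ℚ v p y +ℚ sumℚ s (λ j → a *ℚ c j *ℚ v (σ j) y)
          ≡⟨ cong (_+ℚ sumℚ s (λ j → a *ℚ c j *ℚ v (σ j) y)) (trans (sym (ℚₚ.neg-distribˡ-* B (v p y)))
                (trans (cong -ℚ_ (trans (ℚₚ.*-comm B (v p y)) (sym (sumℚ-*ˡ s (v p y) _))))
                       (sym (sumℚ-neg s _)))) ⟩
        sumℚ s (λ j → -ℚ (v p y *ℚ (c j *ℚ b j))) +ℚ sumℚ s (λ j → a *ℚ c j *ℚ v (σ j) y)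
          ≡⟨ sym (sumℚ-distrib-+ s _ _) ⟩
        sumℚ s (λ j → -ℚ (v p y *ℚ (c j *ℚ b j)) +ℚ a *ℚ c j *ℚ v (σ j) y)
          ≡⟨ sumℚ-cong s (λ j → solve 5 (λ vp cj bj a vj → (:- (vp :* (cj :* bj))) :+ a :* cj :* vj
                                                          := cj :* (a :* vj :+ (:- bj) :* vp))
                                         refl (v p y) (c j) (b j) a (v (σ j) y)) ⟩
        lincomb c eliminated y
          ≡⟨ vanish y ⟩
        0ℚ ∎
        where open ≡-Reasoning

  -- Steinitz exchange by Gaussian elimination on A: if no v j involves w zero, drop w zero and v zero;
  -- otherwise pivot on a row p with A p zero ≢ 0 and eliminate w zero from the other rows.
  fewer-combinations⇒dependent : ∀ r (w : Fin r → I → ℚ) (v : Fin (suc r) → I → ℚ) (A : Fin (suc r) → Fin r → ℚ) →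
                                 (∀ j y → v j y ≡ lincomb (A j) w y) → Dependent (suc r) v
  fewer-combinations⇒dependent zero w v A v≡Aw =
    (λ _ → 1ℚ) , (λ y → trans (cong (λ z → 1ℚ *ℚ z +ℚ 0ℚ) (v≡Aw zero y)) refl) , zero , λ ()
  fewer-combinations⇒dependent (suc r) w v A v≡Aw with any? (λ j → ¬? (A j zero ℚₚ.≟ 0ℚ))
  ... | no noPivot = dependent-tail v
        (fewer-combinations⇒dependent r (w ∘ suc) (v ∘ suc) (λ j → A (suc j) ∘ suc) tail≡)
    where
    tail≡ : ∀ j y → v (suc j) y ≡ lincomb (A (suc j) ∘ suc) (w ∘ suc) y
    tail≡ j y = trans (v≡Aw (suc j) y)
      (trans (cong (λ z → z *ℚ w zero y +ℚ lincomb (A (suc j) ∘ suc) (w ∘ suc) y)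
                   (decidable-stable (A (suc j) zero ℚₚ.≟ 0ℚ) (¬∃⟶∀¬ noPivot (suc j))))
             (*-zeroˡ-+ (w zero y) _))
  ... | yes (p , a≢0) = dependent-unEliminate v p a b a≢0
        (fewer-combinations⇒dependent r (w ∘ suc) (eliminated v p a b) A′ eliminated≡)
    where
    σ = punchIn p
    a = A p zero
    b = λ j → A (σ j) zero
    A′ : Fin (suc r) → Fin r → ℚ
    A′ j l = a *ℚ A (σ j) (suc l) +ℚ (-ℚ b j) *ℚ A p (suc l)
    eliminated≡ : ∀ j y → eliminated v p a b j y ≡ lincomb (A′ j) (w ∘ suc) y
    eliminated≡ j y = begin
      a *ℚ v (σ j) y +ℚ (-ℚ b j) *ℚ v p y
        ≡⟨ cong₂ (λ s t → a *ℚ s +ℚ (-ℚ b j) *ℚ t) (v≡Aw (σ j) y) (v≡Aw p y) ⟩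
      a *ℚ lincomb (A (σ j)) w y +ℚ (-ℚ b j) *ℚ lincomb (A p) w y
        ≡⟨ lincomb-linear w a (-ℚ b j) (A (σ j)) (A p) y ⟩
      (a *ℚ b j +ℚ (-ℚ b j) *ℚ a) *ℚ w zero y +ℚ lincomb (A′ j) (w ∘ suc) y
        ≡⟨ cong (λ z → z *ℚ w zero y +ℚ lincomb (A′ j) (w ∘ suc) y)
                (solve 2 (λ a b → a :* b :+ (:- b) :* a := con 0ℚ) refl a (b j)) ⟩
      0ℚ *ℚ w zero y +ℚ lincomb (A′ j) (w ∘ suc) y
        ≡⟨ *-zeroˡ-+ (w zero y) _ ⟩
      lincomb (A′ j) (w ∘ suc) y ∎
      where open ≡-Reasoning

  combinations⇒¬independent : ∀ (Mat : BMat I) r (w : Fin r → I → ℚ) →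
    (∀ x → Σ (Fin r → ℚ) λ A → ∀ y → toℚ (Mat x y) ≡ lincomb A w y) → ¬ HasIndependentRows Mat (suc r)
  combinations⇒¬independent Mat r w combination (ρ , _ , independent)
    with fewer-combinations⇒dependent r w (λ j y → toℚ (Mat (ρ j) y))
           (λ j → proj₁ (combination (ρ j))) (λ j → proj₂ (combination (ρ j)))
  ... | c , vanishes , j , cⱼ≢0 = cⱼ≢0 (independent c vanishes j)

-- Row indices of a block diagonal matrix

unflatten : ∀ m (N : Fin m → ℕ) → Fin (sumℕ m N) → Idx m N
unflatten (suc m) N x with splitAt (N zero) x
... | inj₁ t = zero , t
... | inj₂ y = let (i , t) = unflatten m (N ∘ suc) y in suc i , t

flatten : ∀ m (N : Fin m → ℕ) → Idx m N → Fin (sumℕ m N)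
flatten (suc m) N (zero  , t) = t ↑ˡ sumℕ m (N ∘ suc)
flatten (suc m) N (suc i , t) = N zero ↑ʳ flatten m (N ∘ suc) (i , t)

flatten-unflatten : ∀ m N x → flatten m N (unflatten m N x) ≡ x
flatten-unflatten (suc m) N x with splitAt (N zero) x in eq
... | inj₁ t = Finₚ.splitAt⁻¹-↑ˡ eq
... | inj₂ y = trans (cong (N zero ↑ʳ_) (flatten-unflatten m (N ∘ suc) y)) (Finₚ.splitAt⁻¹-↑ʳ eq)

unflatten-injective : ∀ m N {x x′} → unflatten m N x ≡ unflatten m N x′ → x ≡ x′
unflatten-injective m N {x} {x′} eq =
  trans (sym (flatten-unflatten m N x)) (trans (cong (flatten m N) eq) (flatten-unflatten m N x′))

unflatten-↑ˡ : ∀ m N (t : Fin (N zero)) → unflatten (suc m) N (t ↑ˡ sumℕ m (N ∘ suc)) ≡ (zero , t)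
unflatten-↑ˡ m N t rewrite Finₚ.splitAt-↑ˡ (N zero) t (sumℕ m (N ∘ suc)) = refl

unflatten-↑ʳ : ∀ m N y → let (i , t) = unflatten m (N ∘ suc) y in unflatten (suc m) N (N zero ↑ʳ y) ≡ (suc i , t)
unflatten-↑ʳ m N y rewrite Finₚ.splitAt-↑ʳ (N zero) (sumℕ m (N ∘ suc)) y = refl

sumℚ-unflatten : ∀ m N (G : Idx m N → ℚ) →
                 sumℚ (sumℕ m N) (G ∘ unflatten m N) ≡ sumℚ m (λ i → sumℚ (N i) (λ t → G (i , t)))
sumℚ-unflatten zero    N G = refl
sumℚ-unflatten (suc m) N G = trans (sumℚ-++ (N zero) (sumℕ m (N ∘ suc)) _)
  (cong₂ _+ℚ_ (sumℚ-cong (N zero) (cong G ∘ unflatten-↑ˡ m N))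
              (trans (sumℚ-cong (sumℕ m (N ∘ suc)) (cong G ∘ unflatten-↑ʳ m N))
                     (sumℚ-unflatten m (N ∘ suc) (λ (i , t) → G (suc i , t)))))

-- A single circulant block

<ᵇ-true : ∀ {a b} → a < b → (a <ᵇ b) ≡ true
<ᵇ-true = Equivalence.to T-≡ ∘ ℕₚ.<⇒<ᵇ

<ᵇ-false : ∀ {a b} → b ≤ a → (a <ᵇ b) ≡ false
<ᵇ-false {a} {b} b≤a with a <ᵇ b in eq
... | false = refl
... | true  = ⊥-elim (ℕₚ.<⇒≱ (ℕₚ.<ᵇ⇒< a b (subst T (sym eq) _)) b≤a)

≤ᵇ-true : ∀ {a b} → a ≤ b → (a ≤ᵇ b) ≡ true
≤ᵇ-true = Equivalence.to T-≡ ∘ ℕₚ.≤⇒≤ᵇ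

≤ᵇ-false : ∀ {a b} → b < a → (a ≤ᵇ b) ≡ false
≤ᵇ-false {a} {b} b<a with a ≤ᵇ b in eq
... | false = refl
... | true  = ⊥-elim (ℕₚ.<⇒≱ b<a (ℕₚ.≤ᵇ⇒≤ a b (subst T (sym eq) _)))

suc-∸1 : ∀ {n} → 0 < n → suc (n ∸ 1) ≡ n
suc-∸1 {suc n} _ = refl

-- For a, b < n, offset n a b is (b − a) mod n, so D_{n,n−k} has a one at (a, b) iff offset n a b < k.
offset : ℕ → ℕ → ℕ → ℕ
offset n a b = if a ≤ᵇ b then b ∸ a else b + n ∸ a

circEntry-offset : ∀ n k (a b : Fin n) → circEntry n k a b ≡ (offset n (toℕ a) (toℕ b) <ᵇ k)
circEntry-offset n k a b with toℕ a ≤ᵇ toℕ b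
... | true  = refl
... | false = refl

offset-≤ : ∀ n {a b} → a ≤ b → offset n a b + a ≡ b
offset-≤ n a≤b rewrite ≤ᵇ-true a≤b = ℕₚ.m∸n+n≡m a≤b

offset-> : ∀ n {a b} → b < a → a ≤ n → offset n a b + a ≡ b + n
offset-> n {a} {b} b<a a≤n rewrite ≤ᵇ-false b<a = ℕₚ.m∸n+n≡m (ℕₚ.≤-trans a≤n (ℕₚ.m≤n+m n b))

offset<n : ∀ n {a b} → a < n → b < n → offset n a b < n
offset<n n {a} {b} a<n b<n with ℕₚ.≤-<-connex a b
... | inj₁ a≤b = ℕₚ.≤-<-trans (ℕₚ.m≤m+n (offset n a b) a) (subst (_< n) (sym (offset-≤ n a≤b)) b<n)
... | inj₂ b<a = ℕₚ.+-cancelʳ-< a (offset n a b) n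
  (subst (_< n + a) (sym (offset-> n b<a (ℕₚ.<⇒≤ a<n)))
         (subst (b + n <_) (ℕₚ.+-comm a n) (ℕₚ.+-monoˡ-< n b<a)))

offset-self : ∀ n a → offset n a a ≡ 0
offset-self n a = ℕₚ.+-cancelʳ-≡ a _ _ (offset-≤ n ℕₚ.≤-refl)

offset-suc-self : ∀ n a → suc a ≤ n → offset n (suc a) a ≡ n ∸ 1
offset-suc-self n a 1+a≤n = ℕₚ.+-cancelʳ-≡ (suc a) _ _ (begin
  offset n (suc a) a + suc a ≡⟨ offset-> n (ℕₚ.n<1+n a) 1+a≤n ⟩
  a + n                      ≡⟨ ℕₚ.+-comm a n ⟩
  n + a                      ≡⟨ cong (_+ a) (sym (suc-∸1 (ℕₚ.<-≤-trans (s≤s z≤n) 1+a≤n))) ⟩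
  suc (n ∸ 1) + a            ≡⟨ sym (ℕₚ.+-suc (n ∸ 1) a) ⟩
  n ∸ 1 + suc a              ∎)
  where open ≡-Reasoning

offset-suc-row : ∀ n {a b} → suc a < n → b < n → b ≢ a → offset n a b ≡ suc (offset n (suc a) b)
offset-suc-row n {a} {b} 1+a<n b<n b≢a = ℕₚ.+-cancelʳ-≡ a _ _ (with-cmp (ℕₚ.<-cmp a b))
  where
  with-cmp : _ → offset n a b + a ≡ suc (offset n (suc a) b) + a
  with-cmp (tri≈ _ a≡b _) = ⊥-elim (b≢a (sym a≡b))
  with-cmp (tri< a<b _ _) = trans (offset-≤ n (ℕₚ.<⇒≤ a<b))
    (trans (sym (offset-≤ n a<b)) (ℕₚ.+-suc _ a))
  with-cmp (tri> _ _ b<a) = trans (offset-> n b<a (ℕₚ.<⇒≤ (ℕₚ.<-trans (ℕₚ.n<1+n a) 1+a<n)))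
    (trans (sym (offset-> n (ℕₚ.m<n⇒m<1+n b<a) (ℕₚ.<⇒≤ 1+a<n))) (ℕₚ.+-suc _ a))

offset-suc-col : ∀ n {a b} → suc b < n → a < n → a ≢ suc b → offset n a (suc b) ≡ suc (offset n a b)
offset-suc-col n {a} {b} 1+b<n a<n a≢1+b = ℕₚ.+-cancelʳ-≡ a _ _ (with-cmp (ℕₚ.<-cmp a (suc b)))
  where
  with-cmp : _ → offset n a (suc b) + a ≡ suc (offset n a b) + a
  with-cmp (tri≈ _ a≡1+b _) = ⊥-elim (a≢1+b a≡1+b)
  with-cmp (tri< a<1+b _ _) = trans (offset-≤ n (ℕₚ.<⇒≤ a<1+b))
    (cong suc (sym (offset-≤ n (ℕₚ.≤-pred a<1+b))))
  with-cmp (tri> _ _ 1+b<a) = trans (offset-> n 1+b<a (ℕₚ.<⇒≤ a<n))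
    (cong suc (sym (offset-> n (ℕₚ.<-trans (ℕₚ.n<1+n b) 1+b<a) (ℕₚ.<⇒≤ a<n))))

offset-wrap : ∀ n {a} → 0 < a → a < n → offset n a 0 ≡ suc (offset n a (n ∸ 1))
offset-wrap n {a} 0<a a<n = ℕₚ.+-cancelʳ-≡ a _ _ (begin
  offset n a 0 + a                ≡⟨ offset-> n 0<a (ℕₚ.<⇒≤ a<n) ⟩
  n                               ≡⟨ sym 1+[n∸1]≡n ⟩
  suc (n ∸ 1)                     ≡⟨ cong suc (sym (offset-≤ n a≤n∸1)) ⟩
  suc (offset n a (n ∸ 1) + a)    ∎)
  where
  open ≡-Reasoning
  1+[n∸1]≡n = suc-∸1 (ℕₚ.<-trans 0<a a<n)
  a≤n∸1 : a ≤ n ∸ 1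
  a≤n∸1 = ℕₚ.≤-pred (subst (a <_) (sym 1+[n∸1]≡n) a<n)

<ᵇ-step : ∀ t k → toℚ (suc t <ᵇ k) +ℚ δ (suc t) k ≡ toℚ (t <ᵇ k)
<ᵇ-step t       zero          = refl
<ᵇ-step zero    (suc zero)    = refl
<ᵇ-step zero    (suc (suc k)) = refl
<ᵇ-step (suc t) (suc k)       = <ᵇ-step t k

module Circulant (n k : ℕ) (0<k : 0 < k) (k≤n : k ≤ n) where

  entry : ℕ → ℕ → ℚ
  entry a b = toℚ (offset n a b <ᵇ k)

  0<n : 0 < n
  0<n = ℕₚ.<-≤-trans 0<k k≤n

  instance
    n-nonZero : NonZero n
    n-nonZero = >-nonZero 0<n

  n∸1<n : n ∸ 1 < n
  n∸1<n = subst (n ∸ 1 <_) (suc-∸1 0<n) (ℕₚ.n<1+n (n ∸ 1))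

  k∸1<k : k ∸ 1 < k
  k∸1<k = subst (k ∸ 1 <_) (suc-∸1 0<k) (ℕₚ.n<1+n (k ∸ 1))

  shift : ℕ → ℕ
  shift a = if a + k <ᵇ n then a + k else a + k ∸ n

  shift-< : ∀ {a} → a + k < n → shift a ≡ a + k
  shift-< {a} p rewrite <ᵇ-true p = refl

  shift-≥ : ∀ {a} → n ≤ a + k → shift a ≡ a + k ∸ n
  shift-≥ {a} p rewrite <ᵇ-false p = refl

  a+k∸n<n : ∀ {a} → a < n → n ≤ a + k → a + k ∸ n < n
  a+k∸n<n {a} a<n n≤a+k = ℕₚ.+-cancelʳ-< n _ n (subst (_< n + n) (sym (ℕₚ.m∸n+n≡m n≤a+k))
    (ℕₚ.<-≤-trans (ℕₚ.+-monoˡ-< k a<n) (ℕₚ.+-monoʳ-≤ n k≤n)))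

  shift-% : ∀ {y} → y < n → (y + k) % n ≡ shift y
  shift-% {y} y<n with y + k ℕₚ.<? n
  ... | yes y+k<n = trans (m<n⇒m%n≡m y+k<n) (sym (shift-< y+k<n))
  ... | no y+k≮n = begin
    (y + k) % n              ≡⟨ cong (_% n) (sym (ℕₚ.m∸n+n≡m n≤y+k)) ⟩
    (y + k ∸ n + n) % n      ≡⟨ [m+n]%n≡m%n (y + k ∸ n) n ⟩
    (y + k ∸ n) % n          ≡⟨ m<n⇒m%n≡m (a+k∸n<n y<n n≤y+k) ⟩
    y + k ∸ n                ≡⟨ sym (shift-≥ n≤y+k) ⟩
    shift y                  ∎
    where
    open ≡-Reasoning
    n≤y+k = ℕₚ.≮⇒≥ y+k≮n

  shift<n : ∀ {a} → a < n → shift a < n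
  shift<n {a} a<n = subst (_< n) (shift-% a<n) (m%n<n (a + k) n)

  shift⁻¹ : ℕ → ℕ
  shift⁻¹ c = if k ≤ᵇ c then c ∸ k else c + n ∸ k

  shift⁻¹-≤ : ∀ {c} → k ≤ c → shift⁻¹ c ≡ c ∸ k
  shift⁻¹-≤ k≤c rewrite ≤ᵇ-true k≤c = refl

  shift⁻¹-> : ∀ {c} → c < k → shift⁻¹ c ≡ c + n ∸ k
  shift⁻¹-> c<k rewrite ≤ᵇ-false c<k = refl

  shift⁻¹-shift : ∀ {p b} → p < n → shift p ≡ suc b → shift⁻¹ (suc b) ≡ p
  shift⁻¹-shift {p} {b} p<n eq with p + k ℕₚ.<? n
  ... | yes p+k<n = begin
    shift⁻¹ (suc b)    ≡⟨ shift⁻¹-≤ (subst (k ≤_) p+k≡1+b (ℕₚ.m≤n+m k p)) ⟩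
    suc b ∸ k          ≡⟨ cong (_∸ k) (sym p+k≡1+b) ⟩
    p + k ∸ k          ≡⟨ ℕₚ.m+n∸n≡m p k ⟩
    p                  ∎
    where
    open ≡-Reasoning
    p+k≡1+b = trans (sym (shift-< p+k<n)) eq
  ... | no p+k≮n = begin
    shift⁻¹ (suc b)    ≡⟨ shift⁻¹-> (subst (_< k) r≡1+b r<k) ⟩
    suc b + n ∸ k      ≡⟨ cong (λ x → x + n ∸ k) (sym r≡1+b) ⟩
    p + k ∸ n + n ∸ k  ≡⟨ cong (_∸ k) (ℕₚ.m∸n+n≡m n≤p+k) ⟩
    p + k ∸ k          ≡⟨ ℕₚ.m+n∸n≡m p k ⟩
    p                  ∎
    where
    open ≡-Reasoning
    n≤p+k = ℕₚ.≮⇒≥ p+k≮n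
    r≡1+b = trans (sym (shift-≥ n≤p+k)) eq
    r<k : p + k ∸ n < k
    r<k = ℕₚ.+-cancelʳ-< n _ k (subst (_< k + n) (sym (ℕₚ.m∸n+n≡m n≤p+k))
            (subst (p + k <_) (ℕₚ.+-comm n k) (ℕₚ.+-monoˡ-< k p<n)))

  shift⁻¹<n : ∀ {x} → x < n → shift⁻¹ x < n
  shift⁻¹<n {x} x<n with k ℕₚ.≤? x
  ... | yes k≤x = subst (_< n) (sym (shift⁻¹-≤ k≤x)) (ℕₚ.≤-<-trans (ℕₚ.m∸n≤m x k) x<n)
  ... | no k≰x = subst (_< n) (sym (shift⁻¹-> (ℕₚ.≰⇒> k≰x)))
    (ℕₚ.+-cancelʳ-< k _ n (subst (_< n + k) (sym (ℕₚ.m∸n+n≡m (ℕₚ.≤-trans k≤n (ℕₚ.m≤n+m n x))))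
      (subst (_< n + k) (ℕₚ.+-comm n x) (ℕₚ.+-monoʳ-< n (ℕₚ.≰⇒> k≰x)))))

  shift≡0 : ∀ {p} → shift p ≡ 0 → p ≡ n ∸ k
  shift≡0 {p} eq with p + k ℕₚ.<? n
  ... | yes p+k<n = ⊥-elim (ℕₚ.<-irrefl (sym (trans (sym (shift-< p+k<n)) eq)) (ℕₚ.<-≤-trans 0<k (ℕₚ.m≤n+m k p)))
  ... | no p+k≮n = sym (trans (cong (_∸ k) (sym p+k≡n)) (ℕₚ.m+n∸n≡m p k))
    where
    n≤p+k = ℕₚ.≮⇒≥ p+k≮n
    p+k≡n : p + k ≡ n
    p+k≡n = trans (sym (ℕₚ.m∸n+n≡m n≤p+k)) (cong (_+ n) (trans (sym (shift-≥ n≤p+k)) eq))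

  δ-row : ∀ {a b} → a < n → b < n → b ≢ a → δ b (shift a) ≡ δ (offset n a b) k
  δ-row {a} {b} a<n b<n b≢a = δ-cong-⇔ to from
    where
    to : b ≡ shift a → offset n a b ≡ k
    to eq with a + k ℕₚ.<? n
    ... | yes a+k<n = ℕₚ.+-cancelʳ-≡ a _ _ (trans (offset-≤ n a≤b) (trans b≡a+k (ℕₚ.+-comm a k)))
      where
      b≡a+k : b ≡ a + k
      b≡a+k = trans eq (shift-< a+k<n)
      a≤b : a ≤ b
      a≤b = subst (a ≤_) (sym b≡a+k) (ℕₚ.m≤m+n a k)
    ... | no a+k≮n = by-order (ℕₚ.≤-<-connex a b)
      where
      b+n≡a+k : b + n ≡ a + k
      b+n≡a+k = trans (cong (_+ n) (trans eq (shift-≥ (ℕₚ.≮⇒≥ a+k≮n)))) (ℕₚ.m∸n+n≡m (ℕₚ.≮⇒≥ a+k≮n))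
      by-order : a ≤ b ⊎ b < a → offset n a b ≡ k
      by-order (inj₂ b<a) = ℕₚ.+-cancelʳ-≡ a _ _ (trans (offset-> n b<a (ℕₚ.<⇒≤ a<n)) (trans b+n≡a+k (ℕₚ.+-comm a k)))
      by-order (inj₁ a≤b) = ⊥-elim (b≢a (ℕₚ.≤-antisym (ℕₚ.+-cancelʳ-≤ n b a
        (subst (_≤ a + n) (sym b+n≡a+k) (ℕₚ.+-monoʳ-≤ a k≤n))) a≤b))
    from : offset n a b ≡ k → b ≡ shift a
    from eq with ℕₚ.≤-<-connex a b
    ... | inj₁ a≤b = trans b≡ (sym (shift-< (subst (_< n) b≡ b<n)))
      where
      b≡ : b ≡ a + k
      b≡ = trans (sym (offset-≤ n a≤b)) (trans (cong (_+ a) eq) (ℕₚ.+-comm k a))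
    ... | inj₂ b<a = sym (trans (shift-≥ (subst (n ≤_) (sym a+k≡b+n) (ℕₚ.m≤n+m n b))) (trans (cong (_∸ n) a+k≡b+n) (ℕₚ.m+n∸n≡m b n)))
      where
      a+k≡b+n : a + k ≡ b + n
      a+k≡b+n = trans (ℕₚ.+-comm a k) (trans (cong (_+ a) (sym eq)) (offset-> n b<a (ℕₚ.<⇒≤ a<n)))

  δ-col : ∀ {a b} → suc b < n → a < n → δ a (shift⁻¹ (suc b)) ≡ δ (suc (offset n a b)) k
  δ-col {a} {b} 1+b<n a<n = δ-cong-⇔ to from
    where
    to : a ≡ shift⁻¹ (suc b) → suc (offset n a b) ≡ k
    to eq with k ℕₚ.≤? suc b
    ... | yes k≤1+b = ℕₚ.+-cancelʳ-≡ a _ _ (trans (cong suc (offset-≤ n a≤b)) (trans (sym a+k≡) (ℕₚ.+-comm a k)))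
      where
      a+k≡ : a + k ≡ suc b
      a+k≡ = trans (cong (_+ k) (trans eq (shift⁻¹-≤ k≤1+b))) (ℕₚ.m∸n+n≡m k≤1+b)
      a≤b : a ≤ b
      a≤b = ℕₚ.≤-pred (subst (suc a ≤_) a+k≡ (subst (_≤ a + k) (ℕₚ.+-comm a 1) (ℕₚ.+-monoʳ-≤ a 0<k)))
    ... | no k≰1+b = by-order (ℕₚ.≤-<-connex a b)
      where
      a+k≡ : a + k ≡ suc b + n
      a+k≡ = trans (cong (_+ k) (trans eq (shift⁻¹-> (ℕₚ.≰⇒> k≰1+b)))) (ℕₚ.m∸n+n≡m (ℕₚ.≤-trans k≤n (ℕₚ.m≤n+m n (suc b))))
      by-order : a ≤ b ⊎ b < a → suc (offset n a b) ≡ k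
      by-order (inj₂ b<a) = ℕₚ.+-cancelʳ-≡ a _ _ (trans (cong suc (offset-> n b<a (ℕₚ.<⇒≤ a<n))) (trans (sym a+k≡) (ℕₚ.+-comm a k)))
      by-order (inj₁ a≤b) = ⊥-elim (ℕₚ.<-irrefl a+k≡ (s≤s (ℕₚ.+-mono-≤ a≤b k≤n)))
    from : suc (offset n a b) ≡ k → a ≡ shift⁻¹ (suc b)
    from eq with ℕₚ.≤-<-connex a b
    ... | inj₁ a≤b = sym (trans (shift⁻¹-≤ k≤1+b) (trans (cong (_∸ k) (sym k+a≡)) (ℕₚ.m+n∸m≡n k a)))
      where
      k+a≡ : k + a ≡ suc b
      k+a≡ = trans (cong (_+ a) (sym eq)) (cong suc (offset-≤ n a≤b))
      k≤1+b : k ≤ suc b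
      k≤1+b = subst (k ≤_) k+a≡ (ℕₚ.m≤m+n k a)
    ... | inj₂ b<a = sym (trans (shift⁻¹-> 1+b<k) (trans (cong (_∸ k) (sym k+a≡)) (ℕₚ.m+n∸m≡n k a)))
      where
      k+a≡ : k + a ≡ suc b + n
      k+a≡ = trans (cong (_+ a) (sym eq)) (cong suc (offset-> n b<a (ℕₚ.<⇒≤ a<n)))
      1+b<k : suc b < k
      1+b<k = ℕₚ.+-cancelʳ-< a (suc b) k (subst (suc b + a <_) (sym k+a≡) (ℕₚ.+-monoʳ-< (suc b) a<n))

  δ-wrap : ∀ {a} → 0 < a → a < n → δ a (n ∸ k) ≡ δ (suc (offset n a (n ∸ 1))) k
  δ-wrap {a} 0<a a<n = trans (δ-cong-⇔ to from) (cong (λ z → δ z k) (offset-wrap n 0<a a<n))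
    where
    offset+a≡n : offset n a 0 + a ≡ n
    offset+a≡n = offset-> n 0<a (ℕₚ.<⇒≤ a<n)
    to : a ≡ n ∸ k → offset n a 0 ≡ k
    to eq = ℕₚ.+-cancelʳ-≡ a _ _ (trans offset+a≡n (trans (sym (ℕₚ.m∸n+n≡m k≤n)) (trans (cong (_+ k) (sym eq)) (ℕₚ.+-comm a k))))
    from : offset n a 0 ≡ k → a ≡ n ∸ k
    from eq = sym (trans (cong (_∸ k) (sym (trans (cong (_+ a) (sym eq)) offset+a≡n))) (ℕₚ.m+n∸m≡n k a))

  lastEntry : ℚ
  lastEntry = toℚ (n ∸ 1 <ᵇ k)

  lastEntry-k≡n : k ≡ n → lastEntry ≡ 1ℚ
  lastEntry-k≡n refl = cong toℚ (<ᵇ-true n∸1<n)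

  lastEntry-k<n : k < n → lastEntry ≡ 0ℚ
  lastEntry-k<n k<n = cong toℚ (<ᵇ-false (ℕₚ.≤-pred (subst (k <_) (sym (suc-∸1 0<n)) k<n)))

  δ-lastEntry : ∀ {x y} → (x ≡ y → k ≡ n) → (k ≡ n → x ≡ y) → δ x y ≡ lastEntry
  δ-lastEntry {x} to from with ℕₚ.m≤n⇒m<n∨m≡n k≤n
  ... | inj₁ k<n = trans (δ-≢ (λ x≡y → ℕₚ.<-irrefl (to x≡y) k<n)) (sym (lastEntry-k<n k<n))
  ... | inj₂ k≡n = trans (cong (δ x) (sym (from k≡n))) (trans (δ-refl x) (sym (lastEntry-k≡n k≡n)))

  δ-shift-self : ∀ a → δ a (shift a) ≡ lastEntry
  δ-shift-self a = δ-lastEntry to from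
    where
    to : a ≡ shift a → k ≡ n
    to a≡shift with a + k ℕₚ.<? n
    ... | yes a+k<n = ⊥-elim (ℕₚ.<-irrefl (trans a≡shift (shift-< a+k<n))
                               (subst (_< a + k) (ℕₚ.+-identityʳ a) (ℕₚ.+-monoʳ-< a 0<k)))
    ... | no a+k≮n = sym (ℕₚ.+-cancelˡ-≡ a n k (trans (cong (_+ n) (trans a≡shift (shift-≥ (ℕₚ.≮⇒≥ a+k≮n))))
                                                      (ℕₚ.m∸n+n≡m (ℕₚ.≮⇒≥ a+k≮n))))
    from : k ≡ n → a ≡ shift a
    from refl = sym (trans (shift-≥ (ℕₚ.m≤n+m k a)) (ℕₚ.m+n∸n≡m a k))

  δ-shift⁻¹-self : ∀ b → suc b < n → δ (suc b) (shift⁻¹ (suc b)) ≡ lastEntry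
  δ-shift⁻¹-self b 1+b<n = δ-lastEntry to from
    where
    to : suc b ≡ shift⁻¹ (suc b) → k ≡ n
    to eq with k ℕₚ.≤? suc b
    ... | yes k≤1+b = ⊥-elim (ℕₚ.<-irrefl (sym (trans (cong (_+ k) (trans eq (shift⁻¹-≤ k≤1+b))) (ℕₚ.m∸n+n≡m k≤1+b)))
                               (subst (_< suc b + k) (ℕₚ.+-identityʳ (suc b)) (ℕₚ.+-monoʳ-< (suc b) 0<k)))
    ... | no k≰1+b = sym (ℕₚ.+-cancelˡ-≡ (suc b) n k
                       (sym (trans (cong (_+ k) (trans eq (shift⁻¹-> (ℕₚ.≰⇒> k≰1+b))))
                                   (ℕₚ.m∸n+n≡m (ℕₚ.≤-trans k≤n (ℕₚ.m≤n+m n (suc b)))))))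
    from : k ≡ n → suc b ≡ shift⁻¹ (suc b)
    from refl = sym (trans (shift⁻¹-> 1+b<n) (ℕₚ.m+n∸n≡m (suc b) k))

  δ-0-n∸k : δ 0 (n ∸ k) ≡ lastEntry
  δ-0-n∸k = δ-lastEntry to from
    where
    to : 0 ≡ n ∸ k → k ≡ n
    to eq = trans (sym (ℕₚ.+-identityˡ k)) (trans (cong (_+ k) eq) (ℕₚ.m∸n+n≡m k≤n))
    from : k ≡ n → 0 ≡ n ∸ k
    from refl = sym (ℕₚ.n∸n≡0 k)

  entry-self : ∀ a → entry a a ≡ 1ℚ
  entry-self a = cong toℚ (trans (cong (_<ᵇ k) (offset-self n a)) (<ᵇ-true 0<k))

  entry-suc-self : ∀ a → suc a ≤ n → entry (suc a) a ≡ lastEntry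
  entry-suc-self a 1+a≤n = cong (λ t → toℚ (t <ᵇ k)) (offset-suc-self n a 1+a≤n)

  entry+δ-offset : ∀ a b a′ b′ → offset n a b ≡ suc (offset n a′ b′) → entry a b +ℚ δ (offset n a b) k ≡ entry a′ b′
  entry+δ-offset a b a′ b′ eq rewrite eq = <ᵇ-step (offset n a′ b′) k

  +δ-≢ : ∀ x {a p} → a ≢ p → x +ℚ δ a p ≡ x
  +δ-≢ x a≢p = trans (cong (x +ℚ_) (δ-≢ a≢p)) (ℚₚ.+-identityʳ x)

  row-step : ∀ {a b} → suc a < n → b < n → entry (suc a) b +ℚ δ b a ≡ entry a b +ℚ δ b (shift a)
  row-step {a} {b} 1+a<n b<n with b ℕₚ.≟ a
  ... | yes refl = begin
    entry (suc b) b +ℚ δ b b     ≡⟨ cong₂ _+ℚ_ (entry-suc-self b (ℕₚ.<⇒≤ 1+a<n)) (δ-refl b) ⟩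
    lastEntry +ℚ 1ℚ              ≡⟨ ℚₚ.+-comm lastEntry 1ℚ ⟩
    1ℚ +ℚ lastEntry              ≡⟨ sym (cong₂ _+ℚ_ (entry-self b) (δ-shift-self b)) ⟩
    entry b b +ℚ δ b (shift b)   ∎
    where open ≡-Reasoning
  ... | no b≢a = begin
    entry (suc a) b +ℚ δ b a             ≡⟨ +δ-≢ _ b≢a ⟩
    entry (suc a) b                      ≡⟨ sym (entry+δ-offset a b (suc a) b (offset-suc-row n 1+a<n b<n b≢a)) ⟩
    entry a b +ℚ δ (offset n a b) k      ≡⟨ cong (entry a b +ℚ_) (sym (δ-row (ℕₚ.<-trans (ℕₚ.n<1+n a) 1+a<n) b<n b≢a)) ⟩
    entry a b +ℚ δ b (shift a)           ∎
    where open ≡-Reasoning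

  col-step : ∀ {a b} → suc b < n → a < n → entry a (suc b) +ℚ δ a (shift⁻¹ (suc b)) ≡ entry a b +ℚ δ a (suc b)
  col-step {a} {b} 1+b<n a<n with a ℕₚ.≟ suc b
  ... | yes refl = begin
    entry (suc b) (suc b) +ℚ δ (suc b) (shift⁻¹ (suc b))  ≡⟨ cong₂ _+ℚ_ (entry-self (suc b)) (δ-shift⁻¹-self b 1+b<n) ⟩
    1ℚ +ℚ lastEntry                                      ≡⟨ ℚₚ.+-comm 1ℚ lastEntry ⟩
    lastEntry +ℚ 1ℚ                                      ≡⟨ sym (cong₂ _+ℚ_ (entry-suc-self b (ℕₚ.<⇒≤ 1+b<n)) (δ-refl (suc b))) ⟩
    entry (suc b) b +ℚ δ (suc b) (suc b)                 ∎
    where open ≡-Reasoning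
  ... | no a≢1+b = begin
    entry a (suc b) +ℚ δ a (shift⁻¹ (suc b))       ≡⟨ cong (entry a (suc b) +ℚ_) (trans (δ-col 1+b<n a<n)
                                                          (cong (λ t → δ t k) (sym (offset-suc-col n 1+b<n a<n a≢1+b)))) ⟩
    entry a (suc b) +ℚ δ (offset n a (suc b)) k     ≡⟨ entry+δ-offset a (suc b) a b (offset-suc-col n 1+b<n a<n a≢1+b) ⟩
    entry a b                                      ≡⟨ sym (+δ-≢ _ a≢1+b) ⟩
    entry a b +ℚ δ a (suc b)                       ∎
    where open ≡-Reasoning

  wrap-step : ∀ {a} → a < n → entry a 0 +ℚ δ a (n ∸ k) ≡ entry a (n ∸ 1) +ℚ δ a 0
  wrap-step {zero} _ = begin
    entry 0 0 +ℚ δ 0 (n ∸ k)     ≡⟨ cong₂ _+ℚ_ (entry-self 0) δ-0-n∸k ⟩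
    1ℚ +ℚ lastEntry              ≡⟨ ℚₚ.+-comm 1ℚ lastEntry ⟩
    lastEntry +ℚ 1ℚ              ∎
    where open ≡-Reasoning
  wrap-step {suc a} 1+a<n = begin
    entry (suc a) 0 +ℚ δ (suc a) (n ∸ k)                   ≡⟨ cong (entry (suc a) 0 +ℚ_) (δ-wrap (s≤s z≤n) 1+a<n) ⟩
    entry (suc a) 0 +ℚ δ (suc (offset n (suc a) (n ∸ 1))) k  ≡⟨ cong (λ t → entry (suc a) 0 +ℚ δ t k) (sym (offset-wrap n (s≤s z≤n) 1+a<n)) ⟩
    entry (suc a) 0 +ℚ δ (offset n (suc a) 0) k             ≡⟨ entry+δ-offset (suc a) 0 (suc a) (n ∸ 1) (offset-wrap n (s≤s z≤n) 1+a<n) ⟩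
    entry (suc a) (n ∸ 1)                                  ≡⟨ sym (+δ-≢ _ {suc a} {0} (λ ())) ⟩
    entry (suc a) (n ∸ 1) +ℚ δ (suc a) 0                   ∎
    where open ≡-Reasoning

  entry-column-k∸1 : ∀ {a} → a < n → entry a (k ∸ 1) ≡ toℚ (a <ᵇ k)
  entry-column-k∸1 {a} a<n with ℕₚ.≤-<-connex a (k ∸ 1)
  ... | inj₁ a≤k∸1 = cong toℚ (trans (<ᵇ-true offset<k) (sym (<ᵇ-true (ℕₚ.≤-<-trans a≤k∸1 k∸1<k))))
    where
    offset<k : offset n a (k ∸ 1) < k
    offset<k = ℕₚ.≤-<-trans (subst (offset n a (k ∸ 1) ≤_) (offset-≤ n a≤k∸1) (ℕₚ.m≤m+n _ a)) k∸1<k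
  ... | inj₂ k∸1<a = cong toℚ (trans (<ᵇ-false k≤offset) (sym (<ᵇ-false k≤a)))
    where
    k≤a : k ≤ a
    k≤a = subst (_≤ a) (suc-∸1 0<k) k∸1<a
    k≤offset : k ≤ offset n a (k ∸ 1)
    k≤offset = subst (_≤ offset n a (k ∸ 1)) (suc-∸1 0<k) (ℕₚ.+-cancelʳ-< a (k ∸ 1) _
      (subst (k ∸ 1 + a <_) (sym (offset-> n k∸1<a (ℕₚ.<⇒≤ a<n))) (ℕₚ.+-monoʳ-< (k ∸ 1) a<n)))

-- Periodic functions

Periodic : ℕ → (ℕ → ℚ) → Set
Periodic p f = ∀ x → f (x + p) ≡ f x

periodic-* : ∀ {p} {f : ℕ → ℚ} j → Periodic p f → Periodic (j * p) f
periodic-* {p} {f} zero    periodic x = cong f (ℕₚ.+-identityʳ x)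
periodic-* {p} {f} (suc j) periodic x =
  trans (cong f (sym (ℕₚ.+-assoc x p (j * p)))) (trans (periodic-* j periodic (x + p)) (periodic x))

periodic-gcd : ∀ {m n} {f : ℕ → ℚ} → Periodic m f → Periodic n f → Periodic (gcd m n) f
periodic-gcd {m} {n} {f} m-periodic n-periodic x with Bézout.identity (gcd-GCD m n)
... | Bézout.+- u v d+vn≡um = trans (sym (periodic-* v n-periodic (x + gcd m n)))
  (trans (cong f (trans (ℕₚ.+-assoc x _ (v * n)) (cong (x +_) d+vn≡um))) (periodic-* u m-periodic x))
... | Bézout.-+ u v d+um≡vn = trans (sym (periodic-* u m-periodic (x + gcd m n)))
  (trans (cong f (trans (ℕₚ.+-assoc x _ (u * m)) (cong (x +_) d+um≡vn))) (periodic-* v n-periodic x))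

periodic-% : ∀ {p} {f : ℕ → ℚ} .{{_ : NonZero p}} → Periodic p f → ∀ x → f x ≡ f (x % p)
periodic-% {p} {f} periodic x = trans (cong f (m≡m%n+[m/n]*n x p)) (periodic-* (x / p) periodic (x % p))

∑-periodic : ∀ {p} {f : ℕ → ℚ} → Periodic p f → ∀ j → ∑ (j * p) f ≡ j · ∑ p f
∑-periodic         periodic zero    = refl
∑-periodic {p} {f} periodic (suc j) = trans (∑-split p (j * p) f)
  (cong (∑ p f +ℚ_) (trans (∑-cong (j * p) (λ a _ → trans (cong f (ℕₚ.+-comm p a)) (periodic a)))
                           (∑-periodic periodic j)))

-- Rank of a single block

module CirculantBlock (n k : ℕ) (0<k : 0 < k) (k≤n : k ≤ n) where

  open Circulant n k 0<k k≤n public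

  g : ℕ
  g = gcd n k

  0<g : 0 < g
  0<g = ℕₚ.n≢0⇒n>0 (gcd[m,n]≢0 n k (inj₂ (λ k≡0 → ℕₚ.<-irrefl (sym k≡0) 0<k)))

  instance
    g-nonZero : NonZero g
    g-nonZero = >-nonZero 0<g

  Qn Qk : ℕ
  Qn = _∣_.quotient (gcd[m,n]∣m n k)
  Qk = _∣_.quotient (gcd[m,n]∣n n k)

  n≡Qn*g : n ≡ Qn * g
  n≡Qn*g = _∣_.equality (gcd[m,n]∣m n k)

  k≡Qk*g : k ≡ Qk * g
  k≡Qk*g = _∣_.equality (gcd[m,n]∣n n k)

  0<Qk : 0 < Qk
  0<Qk = ℕₚ.n≢0⇒n>0 (λ Qk≡0 → ℕₚ.<-irrefl (sym (trans k≡Qk*g (cong (_* g) Qk≡0))) 0<k)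

  Qk≤Qn : Qk ≤ Qn
  Qk≤Qn = ℕₚ.*-cancelʳ-≤ Qk Qn g (subst₂ _≤_ k≡Qk*g n≡Qn*g k≤n)

  k<n⇒Qk<Qn : k < n → Qk < Qn
  k<n⇒Qk<Qn k<n = ℕₚ.*-cancelʳ-< g Qk Qn (subst₂ _<_ k≡Qk*g n≡Qn*g k<n)

  g≤n : g ≤ n
  g≤n = ∣⇒≤ (gcd[m,n]∣m n k)

  rank : ℕ
  rank = n ∸ g + 1

  rank≤n : rank ≤ n
  rank≤n = ℕₚ.≤-trans (ℕₚ.+-monoʳ-≤ (n ∸ g) 0<g) (ℕₚ.≤-reflexive (ℕₚ.m∸n+n≡m g≤n))

  module ConstantColumnSums (c : ℕ → ℚ) (vanishes : ∀ a → rank ≤ a → c a ≡ 0ℚ) (C : ℚ)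
                            (column : ∀ b → b < n → ∑[ a < n ] (c a *ℚ entry a b) ≡ C) where

    column-exchange : ∀ {b b′ x x′} → b < n → b′ < n → x < n → x′ < n →
                      (∀ a → a < n → entry a b +ℚ δ a x ≡ entry a b′ +ℚ δ a x′) → c x ≡ c x′
    column-exchange {b} {b′} {x} {x′} b<n b′<n x<n x′<n exchange = ∙-cancelˡ C (c x) (c x′) (begin
      C +ℚ c x                                                         ≡⟨ sym (cong₂ _+ℚ_ (column b b<n) (∑-δ n c x x<n)) ⟩
      ∑[ a < n ] (c a *ℚ entry a b) +ℚ ∑[ a < n ] (c a *ℚ δ a x)        ≡⟨ sym (∑-distrib-+ n _ _) ⟩
      ∑[ a < n ] (c a *ℚ entry a b +ℚ c a *ℚ δ a x)                    ≡⟨ ∑-cong n (λ a a<n → distrib-exchange a (exchange a a<n)) ⟩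
      ∑[ a < n ] (c a *ℚ entry a b′ +ℚ c a *ℚ δ a x′)                  ≡⟨ ∑-distrib-+ n _ _ ⟩
      ∑[ a < n ] (c a *ℚ entry a b′) +ℚ ∑[ a < n ] (c a *ℚ δ a x′)      ≡⟨ cong₂ _+ℚ_ (column b′ b′<n) (∑-δ n c x′ x′<n) ⟩
      C +ℚ c x′                                                        ∎)
      where
      open ≡-Reasoning
      distrib-exchange : ∀ a → entry a b +ℚ δ a x ≡ entry a b′ +ℚ δ a x′ →
                         c a *ℚ entry a b +ℚ c a *ℚ δ a x ≡ c a *ℚ entry a b′ +ℚ c a *ℚ δ a x′
      distrib-exchange a eq = trans (sym (ℚₚ.*-distribˡ-+ (c a) _ _))
                                    (trans (cong (c a *ℚ_) eq) (ℚₚ.*-distribˡ-+ (c a) _ _))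

    c-shift : ∀ {p} → p < n → c (shift p) ≡ c p
    c-shift {p} p<n with shift p in eq
    ... | zero  = trans (sym (column-exchange 0<n n∸1<n n∸k<n 0<n (λ a → wrap-step))) (cong c (sym (shift≡0 eq)))
      where n∸k<n = ℕₚ.∸-monoʳ-< 0<k k≤n
    ... | suc b = trans (sym (column-exchange 1+b<n b<n (shift⁻¹<n 1+b<n) 1+b<n (λ a → col-step 1+b<n)))
                        (cong c (shift⁻¹-shift p<n eq))
      where
      1+b<n = subst (_< n) eq (shift<n p<n)
      b<n = ℕₚ.<-trans (ℕₚ.n<1+n b) 1+b<n

    c̃ : ℕ → ℚ
    c̃ x = c (x % n)

    c̃≡c : ∀ {a} → a < n → c̃ a ≡ c a
    c̃≡c a<n = cong c (m<n⇒m%n≡m a<n)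

    c̃-periodic : Periodic g c̃
    c̃-periodic = periodic-gcd n-periodic k-periodic
      where
      n-periodic : Periodic n c̃
      n-periodic x = cong c ([m+n]%n≡m%n x n)
      k-periodic : Periodic k c̃
      k-periodic x = begin
        c ((x + k) % n)              ≡⟨ cong c (%-distribˡ-+ x k n) ⟩
        c ((x % n + k % n) % n)      ≡⟨ cong (λ y → c ((y + k % n) % n)) (sym (m%n%n≡m%n x n)) ⟩
        c ((x % n % n + k % n) % n)  ≡⟨ cong c (sym (%-distribˡ-+ (x % n) k n)) ⟩
        c ((x % n + k) % n)          ≡⟨ cong c (shift-% (m%n<n x n)) ⟩
        c (shift (x % n))            ≡⟨ c-shift (m%n<n x n) ⟩
        c (x % n)                    ∎
        where open ≡-Reasoning

    -- The window [rank, n) on which c vanishes contains a full set of nonzero residues mod g.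
    c̃-vanishes : ∀ {ρ} → 0 < ρ → ρ < g → c̃ ρ ≡ 0ℚ
    c̃-vanishes {ρ} 0<ρ ρ<g = begin
      c̃ ρ                ≡⟨ sym (periodic-* (Qn ∸ 1) c̃-periodic ρ) ⟩
      c̃ (ρ + (Qn ∸ 1) * g) ≡⟨ cong (λ y → c̃ (ρ + y)) [Qn∸1]*g≡n∸g ⟩
      c̃ (ρ + (n ∸ g))    ≡⟨ c̃≡c ρ+[n∸g]<n ⟩
      c (ρ + (n ∸ g))    ≡⟨ vanishes _ (subst (_≤ ρ + (n ∸ g)) (ℕₚ.+-comm 1 (n ∸ g)) (ℕₚ.+-monoˡ-≤ (n ∸ g) 0<ρ)) ⟩
      0ℚ                 ∎
      where
      open ≡-Reasoning
      [Qn∸1]*g≡n∸g : (Qn ∸ 1) * g ≡ n ∸ g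
      [Qn∸1]*g≡n∸g = trans (ℕₚ.*-distribʳ-∸ g Qn 1) (cong₂ _∸_ (sym n≡Qn*g) (ℕₚ.*-identityˡ g))
      ρ+[n∸g]<n : ρ + (n ∸ g) < n
      ρ+[n∸g]<n = subst (ρ + (n ∸ g) <_) (ℕₚ.m∸n+n≡m g≤n)
                    (subst (_< n ∸ g + g) (ℕₚ.+-comm (n ∸ g) ρ) (ℕₚ.+-monoʳ-< (n ∸ g) ρ<g))

    ∑-period : ∑ g c̃ ≡ c 0
    ∑-period = begin
      ∑ g c̃          ≡⟨ ∑-truncate c̃ 0<g (λ a 1≤a a<g → c̃-vanishes 1≤a a<g) ⟩
      c̃ 0 +ℚ 0ℚ      ≡⟨ ℚₚ.+-identityʳ _ ⟩
      c̃ 0            ≡⟨ c̃≡c 0<n ⟩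
      c 0            ∎
      where open ≡-Reasoning

    ∑-multiple-of-g : ∀ {L} j → L ≤ n → L ≡ j * g → ∑ L c ≡ j · c 0
    ∑-multiple-of-g {L} j L≤n refl = begin
      ∑ (j * g) c       ≡⟨ ∑-cong (j * g) (λ a a<jg → sym (c̃≡c (ℕₚ.<-≤-trans a<jg L≤n))) ⟩
      ∑ (j * g) c̃       ≡⟨ ∑-periodic c̃-periodic j ⟩
      j · ∑ g c̃         ≡⟨ cong (j ·_) ∑-period ⟩
      j · c 0           ∎
      where open ≡-Reasoning

    column≡Qk·c₀ : C ≡ Qk · c 0
    column≡Qk·c₀ = begin
      C                                        ≡⟨ sym (column (k ∸ 1) (ℕₚ.<-≤-trans k∸1<k k≤n)) ⟩
      ∑[ a < n ] (c a *ℚ entry a (k ∸ 1))      ≡⟨ ∑-cong n (λ a a<n → cong (c a *ℚ_) (entry-column-k∸1 a<n)) ⟩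
      ∑[ a < n ] (c a *ℚ toℚ (a <ᵇ k))         ≡⟨ ∑-truncate _ k≤n beyond-k ⟩
      ∑[ a < k ] (c a *ℚ toℚ (a <ᵇ k))         ≡⟨ ∑-cong k below-k ⟩
      ∑ k c                                    ≡⟨ ∑-multiple-of-g Qk k≤n k≡Qk*g ⟩
      Qk · c 0                                 ∎
      where
      open ≡-Reasoning
      beyond-k : ∀ a → k ≤ a → a < n → c a *ℚ toℚ (a <ᵇ k) ≡ 0ℚ
      beyond-k a k≤a _ = trans (cong (λ b → c a *ℚ toℚ b) (<ᵇ-false k≤a)) (ℚₚ.*-zeroʳ (c a))
      below-k : ∀ a → a < k → c a *ℚ toℚ (a <ᵇ k) ≡ c a
      below-k a a<k = trans (cong (λ b → c a *ℚ toℚ b) (<ᵇ-true a<k)) (ℚₚ.*-identityʳ (c a))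

    total≡Qn·c₀ : ∑ n c ≡ Qn · c 0
    total≡Qn·c₀ = ∑-multiple-of-g Qn ℕₚ.≤-refl n≡Qn*g

    c₀≡0⇒c≡0 : c 0 ≡ 0ℚ → ∀ a → c a ≡ 0ℚ
    c₀≡0⇒c≡0 c₀≡0 a with a ℕₚ.<? n
    ... | no a≮n = vanishes a (ℕₚ.≤-trans rank≤n (ℕₚ.≮⇒≥ a≮n))
    ... | yes a<n = trans (sym (c̃≡c a<n)) (trans (periodic-% c̃-periodic a) (residue (a % g) refl))
      where
      residue : ∀ ρ → ρ ≡ a % g → c̃ ρ ≡ 0ℚ
      residue zero    _    = trans (c̃≡c 0<n) c₀≡0
      residue (suc ρ) ρ≡a%g = c̃-vanishes (s≤s z≤n) (subst (_< g) (sym ρ≡a%g) (m%n<n a g))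

  generator : ℕ → ℕ → ℚ
  generator x b = δ b x +ℚ -ℚ δ b (x + g)

  InSpan : (ℕ → ℚ) → Set
  InSpan v = Σ (ℕ → ℚ) λ β → ∀ b → b < n → v b ≡ ∑[ x < n ∸ g ] (β x *ℚ generator x b)

  span-cong : ∀ {v w} → (∀ b → b < n → v b ≡ w b) → InSpan v → InSpan w
  span-cong v≡w (β , v≡) = β , λ b b<n → trans (sym (v≡w b b<n)) (v≡ b b<n)

  span-zero : InSpan (λ _ → 0ℚ)
  span-zero = (λ _ → 0ℚ) , λ b _ → sym (∑-zero (n ∸ g) (λ x _ → ℚₚ.*-zeroˡ (generator x b)))

  span-+ : ∀ {v w} → InSpan v → InSpan w → InSpan (λ b → v b +ℚ w b)
  span-+ (β , v≡) (γ , w≡) = (λ x → β x +ℚ γ x) , λ b b<n →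
    trans (cong₂ _+ℚ_ (v≡ b b<n) (w≡ b b<n)) (trans (sym (∑-distrib-+ (n ∸ g) _ _))
      (∑-cong (n ∸ g) (λ x _ → sym (ℚₚ.*-distribʳ-+ (generator x b) (β x) (γ x)))))

  span-neg : ∀ {v} → InSpan v → InSpan (λ b → -ℚ v b)
  span-neg (β , v≡) = (λ x → -ℚ β x) , λ b b<n → trans (cong -ℚ_ (v≡ b b<n))
    (trans (sym (∑-neg (n ∸ g) _)) (∑-cong (n ∸ g) (λ x _ → ℚₚ.neg-distribˡ-* (β x) (generator x b))))

  span-generator : ∀ x → x < n ∸ g → InSpan (generator x)
  span-generator x x<n∸g = (λ y → δ y x) , λ b _ → sym (trans
    (∑-cong (n ∸ g) (λ y _ → ℚₚ.*-comm (δ y x) (generator y b))) (∑-δ (n ∸ g) (λ y → generator y b) x x<n∸g))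

  e-difference-multiple : ∀ j ρ → ρ + j * g < n → InSpan (λ b → δ b (ρ + j * g) +ℚ -ℚ δ b ρ)
  e-difference-multiple zero ρ _ = span-cong (λ b _ → sym
    (trans (cong (λ y → δ b y +ℚ -ℚ δ b ρ) (ℕₚ.+-identityʳ ρ)) (ℚₚ.+-inverseʳ (δ b ρ)))) span-zero
  e-difference-multiple (suc j) ρ ρ+[1+j]g<n =
    span-cong telescope (span-+ (e-difference-multiple j ρ y<n) (span-neg (span-generator y y<n∸g)))
    where
    y = ρ + j * g
    y+g≡ : y + g ≡ ρ + suc j * g
    y+g≡ = trans (ℕₚ.+-assoc ρ (j * g) g) (cong (ρ +_) (ℕₚ.+-comm (j * g) g))
    y<n∸g : y < n ∸ g
    y<n∸g = ℕₚ.+-cancelʳ-< g y (n ∸ g) (subst (y + g <_) (sym (ℕₚ.m∸n+n≡m g≤n)) (subst (_< n) (sym y+g≡) ρ+[1+j]g<n))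
    y<n : y < n
    y<n = ℕₚ.<-≤-trans y<n∸g (ℕₚ.m∸n≤m n g)
    telescope : ∀ b → b < n → (δ b y +ℚ -ℚ δ b ρ) +ℚ -ℚ generator y b ≡ δ b (ρ + suc j * g) +ℚ -ℚ δ b ρ
    telescope b _ = trans (solve 3 (λ p r q → (p :+ (:- r)) :+ (:- (p :+ (:- q))) := q :+ (:- r)) refl (δ b y) (δ b ρ) (δ b (y + g)))
                          (cong (λ z → δ b z +ℚ -ℚ δ b ρ) y+g≡)

  e-difference-residue : ∀ {y z} → y < n → z < n → y % g ≡ z % g → InSpan (λ b → δ b y +ℚ -ℚ δ b z)
  e-difference-residue {y} {z} y<n z<n y%g≡z%g =
    span-cong telescope (span-+ (to-residue y<n) (span-neg (to-residue z<n)))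
    where
    to-residue : ∀ {x} → x < n → InSpan (λ b → δ b x +ℚ -ℚ δ b (x % g))
    to-residue {x} x<n = span-cong (λ b _ → cong (λ w → δ b w +ℚ -ℚ δ b (x % g)) (sym (m≡m%n+[m/n]*n x g)))
      (e-difference-multiple (x / g) (x % g) (subst (_< n) (m≡m%n+[m/n]*n x g) x<n))
    telescope : ∀ b → b < n → (δ b y +ℚ -ℚ δ b (y % g)) +ℚ -ℚ (δ b z +ℚ -ℚ δ b (z % g)) ≡ δ b y +ℚ -ℚ δ b z
    telescope b _ = trans (cong (λ w → (δ b y +ℚ -ℚ δ b w) +ℚ -ℚ (δ b z +ℚ -ℚ δ b (z % g))) y%g≡z%g)
      (solve 3 (λ p r q → (p :+ (:- r)) :+ (:- (q :+ (:- r))) := p :+ (:- q)) refl (δ b y) (δ b (z % g)) (δ b z))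

  shift-%g : ∀ a → shift a % g ≡ a % g
  shift-%g a with a + k ℕₚ.<? n
  ... | yes a+k<n = trans (%-congˡ (shift-< a+k<n)) (%-remove-+ʳ a (gcd[m,n]∣n n k))
  ... | no a+k≮n = begin
    shift a % g                ≡⟨ %-congˡ (shift-≥ n≤a+k) ⟩
    (a + k ∸ n) % g            ≡⟨ sym (%-remove-+ʳ (a + k ∸ n) (gcd[m,n]∣m n k)) ⟩
    (a + k ∸ n + n) % g        ≡⟨ %-congˡ (ℕₚ.m∸n+n≡m n≤a+k) ⟩
    (a + k) % g                ≡⟨ %-remove-+ʳ a (gcd[m,n]∣n n k) ⟩
    a % g                      ∎
    where
    open ≡-Reasoning
    n≤a+k = ℕₚ.≮⇒≥ a+k≮n

  row-difference-span : ∀ a → a < n → InSpan (λ b → entry a b +ℚ -ℚ entry 0 b)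
  row-difference-span zero _ = span-cong (λ b _ → sym (ℚₚ.+-inverseʳ (entry 0 b))) span-zero
  row-difference-span (suc a) 1+a<n =
    span-cong step (span-+ (row-difference-span a a<n) (e-difference-residue (shift<n a<n) a<n (shift-%g a)))
    where
    a<n = ℕₚ.<-trans (ℕₚ.n<1+n a) 1+a<n
    step : ∀ b → b < n → (entry a b +ℚ -ℚ entry 0 b) +ℚ (δ b (shift a) +ℚ -ℚ δ b a) ≡ entry (suc a) b +ℚ -ℚ entry 0 b
    step b b<n = begin
      (entry a b +ℚ -ℚ entry 0 b) +ℚ (δ b (shift a) +ℚ -ℚ δ b a)
        ≡⟨ solve 4 (λ d d₀ s t → (d :+ (:- d₀)) :+ (s :+ (:- t)) := ((d :+ s) :+ (:- t)) :+ (:- d₀))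
                 refl (entry a b) (entry 0 b) (δ b (shift a)) (δ b a) ⟩
      ((entry a b +ℚ δ b (shift a)) +ℚ -ℚ δ b a) +ℚ -ℚ entry 0 b
        ≡⟨ cong (λ z → (z +ℚ -ℚ δ b a) +ℚ -ℚ entry 0 b) (sym (row-step 1+a<n b<n)) ⟩
      ((entry (suc a) b +ℚ δ b a) +ℚ -ℚ δ b a) +ℚ -ℚ entry 0 b
        ≡⟨ solve 3 (λ d t d₀ → ((d :+ t) :+ (:- t)) :+ (:- d₀) := d :+ (:- d₀)) refl (entry (suc a) b) (δ b a) (entry 0 b) ⟩
      entry (suc a) b +ℚ -ℚ entry 0 b ∎
      where open ≡-Reasoning

-- A sign argument

x≤x+y : ∀ x {y} → 0ℚ ≤ℚ y → x ≤ℚ x +ℚ y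
x≤x+y x {y} 0≤y = subst (_≤ℚ x +ℚ y) (ℚₚ.+-identityʳ x) (ℚₚ.+-monoʳ-≤ x 0≤y)

x<y+x : ∀ x {y} → 0ℚ <ℚ y → x <ℚ y +ℚ x
x<y+x x {y} 0<y = subst (_<ℚ y +ℚ x) (ℚₚ.+-identityˡ x) (ℚₚ.+-mono-<-≤ 0<y (ℚₚ.≤-refl {x}))

·-zeroʳ : ∀ q → q · 0ℚ ≡ 0ℚ
·-zeroʳ zero    = refl
·-zeroʳ (suc q) = trans (ℚₚ.+-identityˡ _) (·-zeroʳ q)

·-neg : ∀ q x → q · (-ℚ x) ≡ -ℚ (q · x)
·-neg zero    x = refl
·-neg (suc q) x = trans (cong (-ℚ x +ℚ_) (·-neg q x)) (sym (ℚₚ.neg-distrib-+ x (q · x)))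

·-nonNeg : ∀ q {x} → 0ℚ ≤ℚ x → 0ℚ ≤ℚ q · x
·-nonNeg zero    _   = ℚₚ.≤-refl
·-nonNeg (suc q) 0≤x = ℚₚ.≤-trans 0≤x (x≤x+y _ (·-nonNeg q 0≤x))

·-pos : ∀ q {x} → 0 < q → 0ℚ <ℚ x → 0ℚ <ℚ q · x
·-pos (suc q) _ 0<x = ℚₚ.<-≤-trans 0<x (x≤x+y _ (·-nonNeg q (ℚₚ.<⇒≤ 0<x)))

·-monoˡ-≤ : ∀ {q q′ x} → 0ℚ ≤ℚ x → q ≤ q′ → q · x ≤ℚ q′ · x
·-monoˡ-≤ {q} {q′} {x} 0≤x q≤q′ = subst (λ p → q · x ≤ℚ p · x) (ℕₚ.m+[n∸m]≡n q≤q′)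
  (subst (q · x ≤ℚ_) (sym (×-homo-+ x q (q′ ∸ q))) (x≤x+y (q · x) (·-nonNeg (q′ ∸ q) 0≤x)))

·-nonPos : ∀ q {x} → x ≤ℚ 0ℚ → q · x ≤ℚ 0ℚ
·-nonPos zero    _   = ℚₚ.≤-refl
·-nonPos (suc q) {x} x≤0 = subst (x +ℚ q · x ≤ℚ_) (ℚₚ.+-identityʳ 0ℚ) (ℚₚ.+-mono-≤ x≤0 (·-nonPos q x≤0))

·-pos⁻¹ : ∀ q {x} → 0ℚ <ℚ q · x → 0ℚ <ℚ x
·-pos⁻¹ q {x} 0<qx with ℚₚ.<-cmp 0ℚ x
... | tri< 0<x _ _ = 0<x
... | tri≈ _ 0≡x _ = ⊥-elim (ℚₚ.<-irrefl (sym (trans (cong (q ·_) (sym 0≡x)) (·-zeroʳ q))) 0<qx)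
... | tri> _ _ x<0 = ⊥-elim (ℚₚ.<-irrefl refl (ℚₚ.<-≤-trans 0<qx (·-nonPos q (ℚₚ.<⇒≤ x<0))))

·-≡0 : ∀ q {x} → 0 < q → q · x ≡ 0ℚ → x ≡ 0ℚ
·-≡0 q {x} 0<q qx≡0 with ℚₚ.<-cmp x 0ℚ
... | tri≈ _ x≡0 _ = x≡0
... | tri> _ _ 0<x = ⊥-elim (ℚₚ.<-irrefl (sym qx≡0) (·-pos q 0<q 0<x))
... | tri< x<0 _ _ = ⊥-elim (ℚₚ.<-irrefl (sym (trans (·-neg q x) (cong -ℚ_ qx≡0)))
                                          (·-pos q 0<q (ℚₚ.neg-antimono-< x<0)))

sumℚ-nonNeg : ∀ N (f : Fin N → ℚ) → (∀ i → 0ℚ ≤ℚ f i) → 0ℚ ≤ℚ sumℚ N f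
sumℚ-nonNeg zero    f _      = ℚₚ.≤-refl
sumℚ-nonNeg (suc N) f nonNeg = ℚₚ.≤-trans (nonNeg zero) (x≤x+y _ (sumℚ-nonNeg N (f ∘ suc) (nonNeg ∘ suc)))

sumℚ-≥-term : ∀ N {C} (f : Fin N → ℚ) → 0 < N → (∀ i → C ≤ℚ f i) → (∀ i → 0ℚ ≤ℚ f i) → C ≤ℚ sumℚ N f
sumℚ-≥-term (suc N) f _ C≤f nonNeg = ℚₚ.≤-trans (C≤f zero) (x≤x+y _ (sumℚ-nonNeg N (f ∘ suc) (nonNeg ∘ suc)))

module _ {m} (qk qn : Fin (suc m) → ℕ) (qk≤qn : ∀ i → qk i ≤ qn i) where

  -- A positive common value C of the qk i · α i forces every α i > 0, so each qn i · α i is at least C,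
  -- with room to spare either in a second summand or in qn zero · α zero.
  equal-multiples-sum-exceeds : ∀ (α : Fin (suc m) → ℚ) {C} → 0ℚ <ℚ C → (∀ i → qk i · α i ≡ C) → (0 < m ⊎ qk zero < qn zero) →
                                C <ℚ sumℚ (suc m) (λ i → qn i · α i)
  equal-multiples-sum-exceeds α {C} 0<C qkα≡C = exceeds
    where
    0<α : ∀ i → 0ℚ <ℚ α i
    0<α i = ·-pos⁻¹ (qk i) {α i} (subst (0ℚ <ℚ_) (sym (qkα≡C i)) 0<C)
    s : Fin (suc m) → ℚ
    s i = qn i · α i
    C≤s : ∀ i → C ≤ℚ s i
    C≤s i = subst (_≤ℚ s i) (qkα≡C i) (·-monoˡ-≤ {qk i} {qn i} (ℚₚ.<⇒≤ (0<α i)) (qk≤qn i))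
    0≤s : ∀ i → 0ℚ ≤ℚ s i
    0≤s i = ℚₚ.≤-trans (ℚₚ.<⇒≤ 0<C) (C≤s i)
    exceeds : 0 < m ⊎ qk zero < qn zero → C <ℚ sumℚ (suc m) s
    exceeds (inj₁ 0<m) = ℚₚ.<-≤-trans (x<y+x C 0<C)
      (ℚₚ.+-mono-≤ (C≤s zero) (sumℚ-≥-term m (s ∘ suc) 0<m (C≤s ∘ suc) (0≤s ∘ suc)))
    exceeds (inj₂ qk₀<qn₀) = ℚₚ.<-≤-trans
      (subst (C <ℚ_) (cong (α zero +ℚ_) (sym (qkα≡C zero))) (x<y+x C (0<α zero)))
      (ℚₚ.≤-trans (·-monoˡ-≤ {suc (qk zero)} {qn zero} (ℚₚ.<⇒≤ (0<α zero)) qk₀<qn₀) (x≤x+y _ (sumℚ-nonNeg m (s ∘ suc) (0≤s ∘ suc))))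

  equal-multiples⇒zero : ∀ (α : Fin (suc m) → ℚ) {C} → (∀ i → qk i · α i ≡ C) → sumℚ (suc m) (λ i → qn i · α i) ≡ C →
                         (0 < m ⊎ qk zero < qn zero) → C ≡ 0ℚ
  equal-multiples⇒zero α {C} qkα≡C sum≡C more with ℚₚ.<-cmp C 0ℚ
  ... | tri≈ _ C≡0 _ = C≡0
  ... | tri> _ _ 0<C = ⊥-elim (ℚₚ.<-irrefl (sym sum≡C) (equal-multiples-sum-exceeds α 0<C qkα≡C more))
  ... | tri< C<0 _ _ = ⊥-elim (ℚₚ.<-irrefl (sym -sum≡-C)
        (equal-multiples-sum-exceeds (λ i → -ℚ α i) (ℚₚ.neg-antimono-< C<0)
          (λ i → trans (·-neg (qk i) (α i)) (cong -ℚ_ (qkα≡C i))) more))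
    where
    -sum≡-C : sumℚ (suc m) (λ i → qn i · (-ℚ α i)) ≡ -ℚ C
    -sum≡-C = trans (sumℚ-cong (suc m) {g = λ i → -ℚ (qn i · α i)} (λ i → ·-neg (qn i) (α i)))
                    (trans (sumℚ-neg (suc m) (λ i → qn i · α i)) (cong -ℚ_ sum≡C))

-- The block diagonal matrix

toℚ-not : ∀ b → toℚ (not b) ≡ 1ℚ +ℚ -ℚ toℚ b
toℚ-not true  = refl
toℚ-not false = refl

module BlockDiagonal (m′ : ℕ) (n k : Fin (suc m′) → ℕ) (0<k : ∀ i → 0 < k i) (k≤n : ∀ i → k i ≤ n i) where

  m : ℕ
  m = suc m′

  module B (i : Fin m) = CirculantBlock (n i) (k i) (0<k i) (k≤n i)

  M : BMat (Idx m n)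
  M = circBlockDiag m n k

  rank : Fin m → ℕ
  rank i = B.rank i

  r : ℕ
  r = sumℕ m rank

  blockRow : Fin m → ℕ → Idx m n → ℚ
  blockRow i a (j , b) with i ≟ j
  ... | yes refl = B.entry i a (toℕ b)
  ... | no _     = 0ℚ

  M≡blockRow : ∀ i (a : Fin (n i)) y → toℚ (M (i , a) y) ≡ blockRow i (toℕ a) y
  M≡blockRow i a (j , b) with i ≟ j
  ... | yes refl = cong toℚ (circEntry-offset (n i) (k i) a b)
  ... | no _     = refl

  blockRow-same : ∀ i a (b : Fin (n i)) → blockRow i a (i , b) ≡ B.entry i a (toℕ b)
  blockRow-same i a b with i ≟ i
  ... | yes refl = refl
  ... | no i≢i   = ⊥-elim (i≢i refl)

  blockRow-other : ∀ i a j (b : Fin (n j)) → i ≢ j → blockRow i a (j , b) ≡ 0ℚ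
  blockRow-other i a j b i≢j with i ≟ j
  ... | yes i≡j = ⊥-elim (i≢j i≡j)
  ... | no _    = refl

  blockOf : Fin r → Fin m
  blockOf x = proj₁ (unflatten m rank x)

  posOf : (x : Fin r) → Fin (rank (blockOf x))
  posOf x = proj₂ (unflatten m rank x)

  selected : Fin r → Idx m n
  selected x = blockOf x , fromℕ< (ℕₚ.<-≤-trans (Finₚ.toℕ<n (posOf x)) (B.rank≤n (blockOf x)))

  selected-injective : ∀ {x x′} → selected x ≡ selected x′ → x ≡ x′
  selected-injective {x} {x′} eq = unflatten-injective m rank (same-index (cong proj₁ eq)
    (trans (sym (Finₚ.toℕ-fromℕ< _)) (trans (cong (toℕ ∘ proj₂) eq) (Finₚ.toℕ-fromℕ< _))))
    where
    same-index : ∀ {p q : Idx m rank} → proj₁ p ≡ proj₁ q → toℕ (proj₂ p) ≡ toℕ (proj₂ q) → p ≡ q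
    same-index {i , t} refl eq = cong (i ,_) (Finₚ.toℕ-injective eq)

  M-selected : ∀ x y → toℚ (M (selected x) y) ≡ blockRow (blockOf x) (toℕ (posOf x)) y
  M-selected x y = trans (M≡blockRow (blockOf x) _ y) (cong (λ a → blockRow (blockOf x) a y) (Finₚ.toℕ-fromℕ< _))

  sumℚ-blocks : ∀ (F : Fin m → ℕ → ℚ) → sumℚ r (λ x → F (blockOf x) (toℕ (posOf x))) ≡ sumℚ m (λ i → ∑ (rank i) (F i))
  sumℚ-blocks F = trans (sumℚ-unflatten m rank (λ (i , t) → F i (toℕ t))) (sumℚ-cong m (λ i → sumℚ-toℕ (rank i) (F i)))

  module Coefficients (c : Fin r → ℚ) where

    coef : Fin m → ℕ → ℚ
    coef i t with t ℕₚ.<? rank i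
    ... | yes t<rank = c (flatten m rank (i , fromℕ< t<rank))
    ... | no _       = 0ℚ

    coef-vanishes : ∀ i t → rank i ≤ t → coef i t ≡ 0ℚ
    coef-vanishes i t rank≤t with t ℕₚ.<? rank i
    ... | yes t<rank = ⊥-elim (ℕₚ.<⇒≱ t<rank rank≤t)
    ... | no _       = refl

    coef-unflatten : ∀ x → coef (blockOf x) (toℕ (posOf x)) ≡ c x
    coef-unflatten x with toℕ (posOf x) ℕₚ.<? rank (blockOf x)
    ... | yes t<rank = cong c (trans (cong (λ t → flatten m rank (blockOf x , t)) (Finₚ.fromℕ<-toℕ _ t<rank))
                                     (flatten-unflatten m rank x))
    ... | no t≮rank  = ⊥-elim (t≮rank (Finₚ.toℕ<n _))

    sumℚ-by-blocks : ∀ (V : Fin m → ℕ → ℚ) →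
      sumℚ r (λ x → c x *ℚ V (blockOf x) (toℕ (posOf x))) ≡ sumℚ m (λ i → ∑[ t < rank i ] (coef i t *ℚ V i t))
    sumℚ-by-blocks V = trans (sumℚ-cong r (λ x → cong (_*ℚ _) (sym (coef-unflatten x))))
                             (sumℚ-blocks (λ i t → coef i t *ℚ V i t))

    column-of-block : ∀ i (b : Fin (n i)) →
      lincomb c (λ x y → toℚ (M (selected x) y)) (i , b) ≡ ∑[ a < n i ] (coef i a *ℚ B.entry i a (toℕ b))
    column-of-block i b = begin
      lincomb c (λ x y → toℚ (M (selected x) y)) (i , b)
        ≡⟨ sumℚ-cong r (λ x → cong (c x *ℚ_) (M-selected x (i , b))) ⟩
      sumℚ r (λ x → c x *ℚ blockRow (blockOf x) (toℕ (posOf x)) (i , b))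
        ≡⟨ sumℚ-by-blocks (λ j t → blockRow j t (i , b)) ⟩
      sumℚ m (λ j → ∑[ t < rank j ] (coef j t *ℚ blockRow j t (i , b)))
        ≡⟨ sumℚ-single m _ i (λ j j≢i → ∑-zero (rank j) (λ t _ →
             trans (cong (coef j t *ℚ_) (blockRow-other j t i b j≢i)) (ℚₚ.*-zeroʳ (coef j t)))) ⟩
      ∑[ t < rank i ] (coef i t *ℚ blockRow i t (i , b))
        ≡⟨ ∑-cong (rank i) (λ t _ → cong (coef i t *ℚ_) (blockRow-same i t b)) ⟩
      ∑[ t < rank i ] (coef i t *ℚ B.entry i t (toℕ b))
        ≡⟨ sym (∑-truncate _ (B.rank≤n i) (λ t rank≤t _ →
             trans (cong (_*ℚ B.entry i t (toℕ b)) (coef-vanishes i t rank≤t)) (ℚₚ.*-zeroˡ (B.entry i t (toℕ b)))))  ⟩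
      ∑[ a < n i ] (coef i a *ℚ B.entry i a (toℕ b)) ∎
      where open ≡-Reasoning

    sumℚ≡∑-blocks : sumℚ r c ≡ sumℚ m (λ i → ∑ (n i) (coef i))
    sumℚ≡∑-blocks = trans (sumℚ-cong r (λ x → sym (ℚₚ.*-identityʳ (c x))))
      (trans (sumℚ-by-blocks (λ _ _ → 1ℚ)) (sumℚ-cong m (λ i → trans
        (∑-cong (rank i) (λ t _ → ℚₚ.*-identityʳ (coef i t)))
        (sym (∑-truncate (coef i) (B.rank≤n i) (λ t rank≤t _ → coef-vanishes i t rank≤t))))))

  module ConstantColumns (c : Fin r → ℚ) (C : ℚ)
                         (columns : ∀ y → lincomb c (λ x y → toℚ (M (selected x) y)) y ≡ C) where

    open Coefficients c public

    column-sums : ∀ i b → b < n i → ∑[ a < n i ] (coef i a *ℚ B.entry i a b) ≡ C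
    column-sums i b b<n = trans (cong (λ b′ → ∑[ a < n i ] (coef i a *ℚ B.entry i a b′)) (sym (Finₚ.toℕ-fromℕ< b<n)))
      (trans (sym (column-of-block i (fromℕ< b<n))) (columns (i , fromℕ< b<n)))

    module Column (i : Fin m) = B.ConstantColumnSums i (coef i) (coef-vanishes i) C (column-sums i)

    C≡Qk·coef₀ : ∀ i → C ≡ B.Qk i · coef i 0
    C≡Qk·coef₀ i = Column.column≡Qk·c₀ i

    sumℚ≡Qn·coef₀ : sumℚ r c ≡ sumℚ m (λ i → B.Qn i · coef i 0)
    sumℚ≡Qn·coef₀ = trans sumℚ≡∑-blocks (sumℚ-cong m (Column.total≡Qn·c₀))

    C≡0⇒c≡0 : C ≡ 0ℚ → ∀ x → c x ≡ 0ℚ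
    C≡0⇒c≡0 C≡0 x = trans (sym (coef-unflatten x)) (Column.c₀≡0⇒c≡0 i coef₀≡0 _)
      where
      i = blockOf x
      coef₀≡0 = ·-≡0 (B.Qk i) (B.0<Qk i) (trans (sym (C≡Qk·coef₀ i)) C≡0)

  M-independent : RowsIndependent M r selected
  M-independent c columns = ConstantColumns.C≡0⇒c≡0 c 0ℚ columns refl

  complement-independent : (0 < m′ ⊎ k zero < n zero) → RowsIndependent (complement M) r selected
  complement-independent more c columns = C≡0⇒c≡0 C≡0
    where
    -- Rows of the complement are 1 − rows of M, so its vanishing columns make every column sum of M equal Σ c.
    M-columns : ∀ y → lincomb c (λ x y → toℚ (M (selected x) y)) y ≡ sumℚ r c
    M-columns y = sym (x∙y⁻¹≈ε⇒x≈y _ _ (begin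
      sumℚ r c +ℚ -ℚ lincomb c (λ x y → toℚ (M (selected x) y)) y
        ≡⟨ cong (sumℚ r c +ℚ_) (sym (sumℚ-neg r _)) ⟩
      sumℚ r c +ℚ sumℚ r (λ x → -ℚ (c x *ℚ toℚ (M (selected x) y)))
        ≡⟨ sym (sumℚ-distrib-+ r _ _) ⟩
      sumℚ r (λ x → c x +ℚ -ℚ (c x *ℚ toℚ (M (selected x) y)))
        ≡⟨ sumℚ-cong r (λ x → sym (c*[1-t] (c x) (toℚ (M (selected x) y)))) ⟩
      sumℚ r (λ x → c x *ℚ (1ℚ +ℚ -ℚ toℚ (M (selected x) y)))
        ≡⟨ sumℚ-cong r (λ x → cong (c x *ℚ_) (sym (toℚ-not (M (selected x) y)))) ⟩
      lincomb c (λ x y → toℚ (complement M (selected x) y)) y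
        ≡⟨ columns y ⟩
      0ℚ ∎))
      where
      open ≡-Reasoning
      c*[1-t] : ∀ c t → c *ℚ (1ℚ +ℚ -ℚ t) ≡ c +ℚ -ℚ (c *ℚ t)
      c*[1-t] c t = trans (ℚₚ.*-distribˡ-+ c 1ℚ (-ℚ t)) (cong₂ _+ℚ_ (ℚₚ.*-identityʳ c) (sym (ℚₚ.neg-distribʳ-* c t)))
    open ConstantColumns c (sumℚ r c) M-columns
    C≡0 : sumℚ r c ≡ 0ℚ
    C≡0 = equal-multiples⇒zero B.Qk B.Qn B.Qk≤Qn (λ i → coef i 0) (sym ∘ C≡Qk·coef₀) (sym sumℚ≡Qn·coef₀)
            (Sum.map₂ (B.k<n⇒Qk<Qn zero) more)

  generatorRow : Fin m → ℕ → Idx m n → ℚ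
  generatorRow i t (j , b) with i ≟ j
  ... | yes refl = B.generator i t (toℕ b)
  ... | no _     = 0ℚ

  -- Block i contributes its rank i = 1 + (n i ∸ g i) vectors: base i followed by its generators.
  familyAt : (Fin m → Idx m n → ℚ) → Fin m → ℕ → Idx m n → ℚ
  familyAt base i zero    = base i
  familyAt base i (suc t) = generatorRow i t

  spanningFamily : (Fin m → Idx m n → ℚ) → Fin r → Idx m n → ℚ
  spanningFamily base ℓ = familyAt base (blockOf ℓ) (toℕ (posOf ℓ))

  BlockSpanned : BMat (Idx m n) → (Fin m → Idx m n → ℚ) → Set
  BlockSpanned Mat base = ∀ i (a : Fin (n i)) → Σ (ℕ → ℚ) λ β →
    ∀ y → toℚ (Mat (i , a) y) ≡ base i y +ℚ ∑[ t < n i ∸ B.g i ] (β t *ℚ generatorRow i t y)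

  blockSpanned⇒combinations : ∀ Mat base → BlockSpanned Mat base →
    ∀ x → Σ (Fin r → ℚ) λ A → ∀ y → toℚ (Mat x y) ≡ lincomb A (spanningFamily base) y
  blockSpanned⇒combinations Mat base spanned (i , a) = A ∘ blockOf′ , λ y → trans (proj₂ (spanned i a) y) (sym (combination y))
    where
    β = proj₁ (spanned i a)
    blockOf′ : Fin r → Fin m × ℕ
    blockOf′ ℓ = blockOf ℓ , toℕ (posOf ℓ)
    coefficient : ℕ → ℚ
    coefficient zero    = 1ℚ
    coefficient (suc t) = β t
    A : Fin m × ℕ → ℚ
    A (j , t) with j ≟ i
    ... | yes _ = coefficient t
    ... | no _  = 0ℚ
    combination : ∀ y → lincomb (A ∘ blockOf′) (spanningFamily base) y ≡ base i y +ℚ ∑[ t < n i ∸ B.g i ] (β t *ℚ generatorRow i t y)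
    A-same : ∀ t → A (i , t) ≡ coefficient t
    A-same t with i ≟ i
    ... | yes _  = refl
    ... | no i≢i = ⊥-elim (i≢i refl)
    A-other : ∀ j t → j ≢ i → A (j , t) ≡ 0ℚ
    A-other j t j≢i with j ≟ i
    ... | yes j≡i = ⊥-elim (j≢i j≡i)
    ... | no _    = refl
    combination y = begin
      lincomb (A ∘ blockOf′) (spanningFamily base) y
        ≡⟨ sumℚ-blocks (λ j t → A (j , t) *ℚ familyAt base j t y) ⟩
      sumℚ m (λ j → ∑[ t < rank j ] (A (j , t) *ℚ familyAt base j t y))
        ≡⟨ sumℚ-single m _ i (λ j j≢i → ∑-zero (rank j) (λ t _ →
             trans (cong (_*ℚ familyAt base j t y) (A-other j t j≢i)) (ℚₚ.*-zeroˡ (familyAt base j t y)))) ⟩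
      ∑[ t < rank i ] (A (i , t) *ℚ familyAt base i t y)
        ≡⟨ ∑-cong (rank i) (λ t _ → cong (_*ℚ familyAt base i t y) (A-same t)) ⟩
      ∑[ t < n i ∸ B.g i + 1 ] (coefficient t *ℚ familyAt base i t y)
        ≡⟨ cong (λ L → ∑[ t < L ] (coefficient t *ℚ familyAt base i t y)) (ℕₚ.+-comm (n i ∸ B.g i) 1) ⟩
      1ℚ *ℚ base i y +ℚ ∑[ t < n i ∸ B.g i ] (β t *ℚ generatorRow i t y)
        ≡⟨ cong (_+ℚ ∑[ t < n i ∸ B.g i ] (β t *ℚ generatorRow i t y)) (ℚₚ.*-identityˡ (base i y)) ⟩
      base i y +ℚ ∑[ t < n i ∸ B.g i ] (β t *ℚ generatorRow i t y) ∎
      where open ≡-Reasoning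

  blockRow-in-span : ∀ i a (β : ℕ → ℚ) →
    (∀ b → b < n i → B.entry i a b +ℚ -ℚ B.entry i 0 b ≡ ∑[ x < n i ∸ B.g i ] (β x *ℚ B.generator i x b)) →
    ∀ y → blockRow i a y ≡ blockRow i 0 y +ℚ ∑[ t < n i ∸ B.g i ] (β t *ℚ generatorRow i t y)
  blockRow-in-span i a β in-span (j , b) with i ≟ j
  ... | yes refl = trans (solve 2 (λ x y → x := (x :+ (:- y)) :+ y) refl (B.entry i a (toℕ b)) (B.entry i 0 (toℕ b)))
                         (trans (cong (_+ℚ B.entry i 0 (toℕ b)) (in-span (toℕ b) (Finₚ.toℕ<n b))) (ℚₚ.+-comm _ (B.entry i 0 (toℕ b))))
  ... | no _     = sym (trans (ℚₚ.+-identityˡ _) (∑-zero (n i ∸ B.g i) (λ t _ → ℚₚ.*-zeroʳ (β t))))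

  M-spanned : BlockSpanned M (λ i → blockRow i 0)
  M-spanned i a = β , λ y → trans (M≡blockRow i a y) (blockRow-in-span i (toℕ a) β in-span y)
    where
    open Σ (B.row-difference-span i (toℕ a) (Finₚ.toℕ<n a)) renaming (proj₁ to β; proj₂ to in-span)

  complement-spanned : BlockSpanned (complement M) (λ i y → 1ℚ +ℚ -ℚ blockRow i 0 y)
  complement-spanned i a = (λ t → -ℚ β t) , λ y → begin
    toℚ (not (M (i , a) y))                       ≡⟨ toℚ-not (M (i , a) y) ⟩
    1ℚ +ℚ -ℚ toℚ (M (i , a) y)                    ≡⟨ cong (λ z → 1ℚ +ℚ -ℚ z) (in-span y) ⟩
    1ℚ +ℚ -ℚ (blockRow i 0 y +ℚ S y)              ≡⟨ solve 3 (λ o r s → o :+ (:- (r :+ s)) := (o :+ (:- r)) :+ (:- s)) refl 1ℚ (blockRow i 0 y) (S y) ⟩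
    (1ℚ +ℚ -ℚ blockRow i 0 y) +ℚ -ℚ S y           ≡⟨ cong ((1ℚ +ℚ -ℚ blockRow i 0 y) +ℚ_) (trans (sym (∑-neg (n i ∸ B.g i) _))
                                                      (∑-cong (n i ∸ B.g i) (λ t _ → ℚₚ.neg-distribˡ-* (β t) (generatorRow i t y)))) ⟩
    (1ℚ +ℚ -ℚ blockRow i 0 y) +ℚ ∑[ t < n i ∸ B.g i ] ((-ℚ β t) *ℚ generatorRow i t y) ∎
    where
    open ≡-Reasoning
    open Σ (M-spanned i a) renaming (proj₁ to β; proj₂ to in-span)
    S : Idx m n → ℚ
    S y = ∑[ t < n i ∸ B.g i ] (β t *ℚ generatorRow i t y)

  rank-M : IsRank M r
  rank-M = (selected , selected-injective , M-independent)
         , combinations⇒¬independent M r (spanningFamily base) (blockSpanned⇒combinations M base M-spanned)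
    where base = λ i → blockRow i 0

  rank-complement : (0 < m′ ⊎ k zero < n zero) → IsRank (complement M) r
  rank-complement more = (selected , selected-injective , complement-independent more)
    , combinations⇒¬independent (complement M) r (spanningFamily base)
        (blockSpanned⇒combinations (complement M) base complement-spanned)
    where base = λ i y → 1ℚ +ℚ -ℚ blockRow i 0 y

circEntry-full : ∀ n (a b : Fin n) → circEntry n n a b ≡ true
circEntry-full n a b = trans (circEntry-offset n n a b) (<ᵇ-true (offset<n n (Finₚ.toℕ<n a) (Finₚ.toℕ<n b)))

¬allOne⇒proper : ∀ m′ (n k : Fin (suc m′) → ℕ) → (∀ i → k i ≤ n i) →
                 ¬ allOne (circBlockDiag (suc m′) n k) → 0 < m′ ⊎ k zero < n zero
¬allOne⇒proper (suc m′) n k k≤n _ = inj₁ (s≤s z≤n)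
¬allOne⇒proper zero n k k≤n notAllOne with ℕₚ.m≤n⇒m<n∨m≡n (k≤n zero)
... | inj₁ k<n = inj₂ k<n
... | inj₂ k≡n = ⊥-elim (notAllOne allOne-block)
  where
  allOne-block : allOne (circBlockDiag 1 n k)
  allOne-block (zero , a) (zero , b) = subst (λ z → circEntry (n zero) z a b ≡ true) (sym k≡n) (circEntry-full (n zero) a b)

lemma2p5 : (m : ℕ) → 1 ≤ m → (n k : Fin m → ℕ) →
    (∀ i → 0 < k i) → (∀ i → k i ≤ n i) →
    ¬ allOne (circBlockDiag m n k) →
    IsRank (circBlockDiag m n k) (sumℕ m (λ i → n i ∸ gcd (n i) (k i) + 1))
    × IsRank (complement (circBlockDiag m n k)) (sumℕ m (λ i → n i ∸ gcd (n i) (k i) + 1))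
lemma2p5 zero     () n k
lemma2p5 (suc m′) _  n k 0<k k≤n notAllOne = rank-M , rank-complement (¬allOne⇒proper m′ n k k≤n notAllOne)
  where open BlockDiagonal m′ n k 0<k k≤n
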